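{- Consider an execution of the DRL transition system, with $\alpha_t$ the knowledge-set map of the configuration at time $t$, and a refob $x: A\to B$. Let $t_1,t_2$ be times such that $x$ has not yet been deactivated at $t_1$ and $x$ has not yet been released at $t_2$ (possibly $t_1,t_2$ are before the creation of $x$). Suppose $\alpha_{t_1}(A)\vdash\mathrm{SentCount}(x,n)$ and $\alpha_{t_2}(B)\vdash\mathrm{RecvCount}(x,m)$ and, if $t_1<t_2$, that $A$ sends no messages along $x$ during $[t_1,t_2]$. Then $\max(n-m,0)$ is the number of messages sent along $x$ before $t_1$ that were not received before $t_2$.
   Context: DRL transition system. Refobs are triples $x: A\to B$ (owner $A$, target $B$, unique token $x$). Facts: $\mathrm{Created}(x)$, $\mathrm{Released}(x)$, $\mathrm{CreatedUsing}(x,y)$, $\mathrm{Activated}(x)$, $\mathrm{Unreleased}(x)$, $\mathrm{SentCount}(x,n)$, $\mathrm{RecvCount}(x,n)$; $\Phi\vdash\phi$ is derivability from a knowledge set $\Phi$ in first-order logic plus: absent any $\mathrm{SentCount}(x,n)$, $\Phi\vdash\mathrm{SentCount}(x,0)$; likewise $\mathrm{RecvCount}$; $\mathrm{Created}(x)\wedge\neg\mathrm{Released}(x)$ yields $\mathrm{Unreleased}(x)$; $\mathrm{CreatedUsing}(x,y)$ yields $\mathrm{Created}(y)$. $\mathrm{IncSent}$/$\mathrm{IncRecv}$ increment the (default 0) count. Configurations $(\alpha,\mu,\rho,\chi)$ (internal actors' knowledge sets, busy or idle; undelivered message multisets; receptionists; external actors). Initial configuration: one busy actor $A$ with $\{\mathrm{Activated}(x:A\to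 E),\mathrm{Created}(y:A\to A),\mathrm{Activated}(y:A\to A)\}$, no messages, $\rho=\emptyset$, $\chi=\{E\}$. Rules: Spawn (busy $A$ spawns fresh $B$ with fresh $x,y$: $A$ adds $\mathrm{Activated}(x:A\to B)$, $B$ starts busy with $\{\mathrm{Created}(x),\mathrm{Created}(y:B\to B),\mathrm{Activated}(y)\}$); Send (busy $A$ with $\Phi\vdash\mathrm{Activated}(x:A\to B)$ and $\Phi\vdash\mathrm{Activated}(y_i:A\to C_i)$, fresh $z_i$: increments send count of $x$, adds $\mathrm{CreatedUsing}(y_i,z_i)$, sends $\mathrm{app}(x,\{z_i:B\to C_i\})$ to $B$ along $x$); Receive (idle $B$ consumes $\mathrm{app}(x,R)$, becomes busy, increments receive count of $x$, adds $\mathrm{Activated}(z)$, $z\in R$); Idle; SendInfo (busy $A$ removes $\mathrm{CreatedUsing}(y:A\to C,z:B\to C)$, increments send count of $y$, sends $\mathrm{info}(y,z,B)$ to $C$ along $y$); Info (idle $C$ consumes it, increments receive count of $y$, adds $\mathrm{Created}(z)$); SendRelease (busy $A$ with $\mathrm{Activated}(x:A\to B),\mathrm{SentCount}(x,n)$ and no $\mathrm{CreatedUsing}(x,\cdot)$ removes both facts, thereby deactivating $x$, and sends $\mathrm{release}(x,n)$ to $B$ along $x$); Release (idle $B$ with $\Phi\vdash\mathrm{RecvCount}(x,n)$ consumes $\mathrm{release}(x,n)$ and adds $\mathrm{Released}(x)$, thereby releasing $x$); Compaction (idle $C$ removes $\mathrm{Created}(x)$, $\mathrm{Released}(x)$,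 $\mathrm{RecvCount}(x,\cdot)$); Snapshot (no change); In, Out, ReleaseOut, InfoOut (interaction with external actors). Messages along $x$ are the app and info messages sent using $x$ (and the release message for $x$). Time $t$ refers to the $t$-th configuration of the execution. -}

module Defs where

open import Level using (Level)
open import Data.Nat using (ℕ; zero; suc; _≤_; _<_; _≟_)
open import Data.Bool using (if_then_else_)
open import Data.Maybe using (Maybe; just; nothing)
open import Data.Product using (Σ; ∃; ∃-syntax; _×_; _,_; proj₁; proj₂)
open import Data.Sum using (_⊎_)
open import Data.List using (List; []; _∷_; _++_; map; length)
open import Data.List.Membership.Propositional using (_∈_)
open import Data.List.Relation.Unary.All using (All)
open import Data.List.Relation.Unary.Any using (Any)
open import Data.List.Relation.Unary.Unique.Propositional using (Unique)
open import Data.Empty using (⊥)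
open import Data.Unit using (⊤)
open import Relation.Nullary using (¬_; does)
open import Relation.Binary.PropositionalEquality using (_≡_; _≢_)
open import Function.Bundles using (_⇔_)

Actor : Set
Actor = ℕ

Token : Set
Token = ℕ

record Refob : Set where
  constructor _∶_⇒_
  field
    tok : Token
    own : Actor
    tgt : Actor
open Refob public

data Fact : Set where
  Created Released Activated Unreleased : Refob → Fact
  CreatedUsing : Refob → Refob → Fact
  SentCount RecvCount : Refob → ℕ → Fact

Knowledge : Set₁
Knowledge = Fact → Set

data _⊢_ (Φ : Knowledge) : Fact → Set where
  ax    : ∀ {φ} → Φ φ → Φ ⊢ φ
  sent0 : ∀ {x} → (∀ n → ¬ Φ (SentCount x n)) → Φ ⊢ SentCount x 0
  recv0 : ∀ {x} → (∀ n → ¬ Φ (RecvCount x n)) → Φ ⊢ RecvCount x 0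
  -- Released facts are only derivable as axioms, so "¬ Φ ⊢ Released x"
  -- is the same as "¬ Φ (Released x)"
  unrel : ∀ {x} → Φ ⊢ Created x → ¬ Φ (Released x) → Φ ⊢ Unreleased x
  cu    : ∀ {x y} → Φ ⊢ CreatedUsing x y → Φ ⊢ Created y

_⊕_ : Knowledge → Fact → Knowledge
(Φ ⊕ φ) ψ = Φ ψ ⊎ ψ ≡ φ

_⊖_ : Knowledge → Fact → Knowledge
(Φ ⊖ φ) ψ = Φ ψ × ψ ≢ φ

addAll : Knowledge → List Fact → Knowledge
addAll Φ fs ψ = Φ ψ ⊎ ψ ∈ fs

dropRecv : Knowledge → Refob → Knowledge
dropRecv Φ x ψ = Φ ψ × (∀ n → ψ ≢ RecvCount x n)

-- IncSent / IncRecv, where n is the current (possibly default) count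
incSent : Refob → ℕ → Knowledge → Knowledge
incSent x n Φ = (Φ ⊖ SentCount x n) ⊕ SentCount x (suc n)

incRecv : Refob → ℕ → Knowledge → Knowledge
incRecv x n Φ = (Φ ⊖ RecvCount x n) ⊕ RecvCount x (suc n)

-- Messages (tagged with the time step at which they were sent, so that
-- each message in the multiset μ has an identity)

data Msg : Set where
  app     : Refob → List Refob → Msg
  info    : Refob → Refob → Actor → Msg
  release : Refob → ℕ → Msg

along : Msg → Refob
along (app x _)      = x
along (info y _ _)   = y
along (release x _)  = x

record TMsg : Set where
  constructor ⟨_,_⟩
  field
    tag  : ℕ
    body : Msg
open TMsg public

data Status : Set where
  busy idle : Status

record Config : Set₁ where
  field
    α : Actor → Maybe (Knowledge × Status)   -- internal actors
    μ : List TMsg                            -- undelivered messages (a multiset)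
    ρ : Actor → Set                          -- receptionists
    χ : Actor → Set                          -- external actors
open Config public

IsJust : {S : Set₁} → Maybe S → Set
IsJust nothing  = ⊥
IsJust (just _) = ⊤

Internal : Config → Actor → Set
Internal C A = IsJust (α C A)

upd : {S : Set₁} → (Actor → Maybe S) → Actor → S → Actor → Maybe S
upd f A v B = if does (B ≟ A) then just v else f B

TokInFact : Token → Fact → Set
TokInFact k (Created x)        = tok x ≡ k
TokInFact k (Released x)       = tok x ≡ k
TokInFact k (Activated x)      = tok x ≡ k
TokInFact k (Unreleased x)     = tok x ≡ k
TokInFact k (CreatedUsing x y) = tok x ≡ k ⊎ tok y ≡ k
TokInFact k (SentCount x _)    = tok x ≡ k
TokInFact k (RecvCount x _)    = tok x ≡ k

TokInMsg : Token → Msg → Set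
TokInMsg k (app x R)      = tok x ≡ k ⊎ Any (λ z → tok z ≡ k) R
TokInMsg k (info y z _)   = tok y ≡ k ⊎ tok z ≡ k
TokInMsg k (release x _)  = tok x ≡ k

KnowsTok : Token → Maybe (Knowledge × Status) → Set
KnowsTok k nothing        = ⊥
KnowsTok k (just (Φ , _)) = ∃ λ φ → Φ φ × TokInFact k φ

OccursTok : Token → Config → Set
OccursTok k C = (∃ λ A → KnowsTok k (α C A)) ⊎ (∃ λ m → m ∈ μ C × TokInMsg k (body m))

initKnow : Actor → Actor → Token → Token → Knowledge
initKnow a e k k' ψ =
  ψ ≡ Activated (k ∶ a ⇒ e) ⊎ ψ ≡ Created (k' ∶ a ⇒ a) ⊎ ψ ≡ Activated (k' ∶ a ⇒ a)

Init : Actor → Actor → Token → Token → Config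
Init a e k k' = record
  { α = λ B → if does (B ≟ a) then just (initKnow a e k k' , busy) else nothing
  ; μ = []
  ; ρ = λ _ → ⊥
  ; χ = λ B → B ≡ e
  }

spawnKnow : Actor → Actor → Token → Token → Knowledge
spawnKnow A B k k' ψ =
  ψ ≡ Created (k ∶ A ⇒ B) ⊎ ψ ≡ Created (k' ∶ B ⇒ B) ⊎ ψ ≡ Activated (k' ∶ B ⇒ B)

data Event : Set where
  eSpawn       : Actor → Actor → Event
  eSend        : Actor → TMsg → Event
  eReceive     : Actor → TMsg → Event
  eIdle        : Actor → Event
  eSendInfo    : Actor → TMsg → Event
  eInfo        : Actor → TMsg → Event
  eSendRelease : Actor → TMsg → Event
  eRelease     : Actor → TMsg → Event
  eCompaction  : Actor → Refob → Event
  eSnapshot    : Actor → Event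
  eIn          : Actor → TMsg → Event   -- sending (external) actor
  eOut         : TMsg → Event
  eReleaseOut  : TMsg → Event
  eInfoOut     : TMsg → Event

data Emits : Event → Actor → TMsg → Set where
  em-send    : ∀ {A m} → Emits (eSend A m) A m
  em-info    : ∀ {A m} → Emits (eSendInfo A m) A m
  em-release : ∀ {A m} → Emits (eSendRelease A m) A m
  em-in      : ∀ {A m} → Emits (eIn A m) A m

data Consumes : Event → TMsg → Set where
  co-receive    : ∀ {A m} → Consumes (eReceive A m) m
  co-info       : ∀ {A m} → Consumes (eInfo A m) m
  co-release    : ∀ {A m} → Consumes (eRelease A m) m
  co-out        : ∀ {m} → Consumes (eOut m) m
  co-releaseOut : ∀ {m} → Consumes (eReleaseOut m) m
  co-infoOut    : ∀ {m} → Consumes (eInfoOut m) m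

data Deactivates : Event → Refob → Set where
  deact : ∀ {A s x n} → Deactivates (eSendRelease A ⟨ s , release x n ⟩) x

data Releases : Event → Refob → Set where
  rel : ∀ {B s x n} → Releases (eRelease B ⟨ s , release x n ⟩) x

-- Transition rules.  Step t Used C e C' : at time t, with Used the set
-- of tokens that occurred so far in the execution, C → C' via event e.

Triple : Set
Triple = Token × Actor × Token   -- (token of y : A → Cᵢ , Cᵢ , fresh token zᵢ)

newRef : Actor → Triple → Refob
newRef B (_ , Ci , z) = z ∶ B ⇒ Ci

cuFact : Actor → Actor → Triple → Fact
cuFact A B (y , Ci , z) = CreatedUsing (y ∶ A ⇒ Ci) (z ∶ B ⇒ Ci)

data Step (t : ℕ) (Used : Token → Set) : Config → Event → Config → Set₁ where

  spawn : ∀ {C Φ A B k k'} →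
    α C A ≡ just (Φ , busy) →
    ¬ Internal C B → ¬ χ C B →
    ¬ Used k → ¬ Used k' → k ≢ k' →
    Step t Used C (eSpawn A B)
      (record C { α = upd (upd (α C) A (Φ ⊕ Activated (k ∶ A ⇒ B) , busy)) B
                            (spawnKnow A B k k' , busy) })

  send : ∀ {C Φ A B kx n} (ys : List Triple) →
    α C A ≡ just (Φ , busy) →
    Φ ⊢ Activated (kx ∶ A ⇒ B) →
    All (λ p → Φ ⊢ Activated (proj₁ p ∶ A ⇒ proj₁ (proj₂ p))) ys →
    All (λ p → ¬ Used (proj₂ (proj₂ p))) ys →
    Unique (map (λ p → proj₂ (proj₂ p)) ys) →
    Φ ⊢ SentCount (kx ∶ A ⇒ B) n →
    Step t Used C (eSend A ⟨ t , app (kx ∶ A ⇒ B) (map (newRef B) ys) ⟩)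
      (record C { α = upd (α C) A
                        (addAll (incSent (kx ∶ A ⇒ B) n Φ) (map (cuFact A B) ys) , busy)
                ; μ = ⟨ t , app (kx ∶ A ⇒ B) (map (newRef B) ys) ⟩ ∷ μ C })

  receive : ∀ {C Φ B μ₁ μ₂ s x R n} →
    α C B ≡ just (Φ , idle) →
    μ C ≡ μ₁ ++ ⟨ s , app x R ⟩ ∷ μ₂ → tgt x ≡ B →
    Φ ⊢ RecvCount x n →
    Step t Used C (eReceive B ⟨ s , app x R ⟩)
      (record C { α = upd (α C) B (addAll (incRecv x n Φ) (map Activated R) , busy)
                ; μ = μ₁ ++ μ₂ })

  idleR : ∀ {C Φ A} →
    α C A ≡ just (Φ , busy) →
    Step t Used C (eIdle A) (record C { α = upd (α C) A (Φ , idle) })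

  sendInfo : ∀ {C Φ A B Cc ky kz n} →
    α C A ≡ just (Φ , busy) →
    Φ (CreatedUsing (ky ∶ A ⇒ Cc) (kz ∶ B ⇒ Cc)) →
    Φ ⊢ SentCount (ky ∶ A ⇒ Cc) n →
    Step t Used C (eSendInfo A ⟨ t , info (ky ∶ A ⇒ Cc) (kz ∶ B ⇒ Cc) B ⟩)
      (record C { α = upd (α C) A
                    (incSent (ky ∶ A ⇒ Cc) n (Φ ⊖ CreatedUsing (ky ∶ A ⇒ Cc) (kz ∶ B ⇒ Cc)) , busy)
                ; μ = ⟨ t , info (ky ∶ A ⇒ Cc) (kz ∶ B ⇒ Cc) B ⟩ ∷ μ C })

  infoR : ∀ {C Φ Cc μ₁ μ₂ s y z B n} →
    α C Cc ≡ just (Φ , idle) →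
    μ C ≡ μ₁ ++ ⟨ s , info y z B ⟩ ∷ μ₂ → tgt y ≡ Cc →
    Φ ⊢ RecvCount y n →
    Step t Used C (eInfo Cc ⟨ s , info y z B ⟩)
      (record C { α = upd (α C) Cc (incRecv y n Φ ⊕ Created z , idle)
                ; μ = μ₁ ++ μ₂ })

  sendRelease : ∀ {C Φ A B kx n} →
    α C A ≡ just (Φ , busy) →
    Φ ⊢ Activated (kx ∶ A ⇒ B) →
    Φ ⊢ SentCount (kx ∶ A ⇒ B) n →
    (∀ z → ¬ (Φ ⊢ CreatedUsing (kx ∶ A ⇒ B) z)) →
    Step t Used C (eSendRelease A ⟨ t , release (kx ∶ A ⇒ B) n ⟩)
      (record C { α = upd (α C) A
                    ((Φ ⊖ Activated (kx ∶ A ⇒ B)) ⊖ SentCount (kx ∶ A ⇒ B) n , busy)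
                ; μ = ⟨ t , release (kx ∶ A ⇒ B) n ⟩ ∷ μ C })

  releaseR : ∀ {C Φ B μ₁ μ₂ s x n} →
    α C B ≡ just (Φ , idle) →
    μ C ≡ μ₁ ++ ⟨ s , release x n ⟩ ∷ μ₂ → tgt x ≡ B →
    Φ ⊢ RecvCount x n →
    Step t Used C (eRelease B ⟨ s , release x n ⟩)
      (record C { α = upd (α C) B (Φ ⊕ Released x , idle)
                ; μ = μ₁ ++ μ₂ })

  compaction : ∀ {C Φ Cc x} →
    α C Cc ≡ just (Φ , idle) → tgt x ≡ Cc →
    Φ (Created x) → Φ (Released x) →
    Step t Used C (eCompaction Cc x)
      (record C { α = upd (α C) Cc (dropRecv ((Φ ⊖ Created x) ⊖ Released x) x , idle) })

  snapshot : ∀ {C Φ A} →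
    α C A ≡ just (Φ , idle) →
    Step t Used C (eSnapshot A) C

  inR : ∀ {C A E k} (zs : List (Token × Actor)) →
    ρ C A → χ C E →
    ¬ Used k → All (λ p → ¬ Used (proj₁ p)) zs →
    Unique (k ∷ map proj₁ zs) →
    All (λ p → ρ C (proj₂ p) ⊎ χ C (proj₂ p) ⊎ (¬ Internal C (proj₂ p) × ¬ χ C (proj₂ p))) zs →
    Step t Used C (eIn E ⟨ t , app (k ∶ E ⇒ A) (map (λ p → proj₁ p ∶ A ⇒ proj₂ p) zs) ⟩)
      (record C { μ = ⟨ t , app (k ∶ E ⇒ A) (map (λ p → proj₁ p ∶ A ⇒ proj₂ p) zs) ⟩ ∷ μ C
                ; χ = λ D → χ C D ⊎ (D ∈ map proj₂ zs × ¬ Internal C D) })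

  out : ∀ {C μ₁ μ₂ s x R} →
    μ C ≡ μ₁ ++ ⟨ s , app x R ⟩ ∷ μ₂ → χ C (tgt x) →
    Step t Used C (eOut ⟨ s , app x R ⟩)
      (record C { μ = μ₁ ++ μ₂
                ; ρ = λ D → ρ C D ⊎ (D ∈ map tgt R × Internal C D) })

  releaseOut : ∀ {C μ₁ μ₂ s x n} →
    μ C ≡ μ₁ ++ ⟨ s , release x n ⟩ ∷ μ₂ → χ C (tgt x) →
    Step t Used C (eReleaseOut ⟨ s , release x n ⟩) (record C { μ = μ₁ ++ μ₂ })

  infoOut : ∀ {C μ₁ μ₂ s y z B} →
    μ C ≡ μ₁ ++ ⟨ s , info y z B ⟩ ∷ μ₂ → χ C (tgt y) →
    Step t Used C (eInfoOut ⟨ s , info y z B ⟩) (record C { μ = μ₁ ++ μ₂ })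

-- Executions (finite, of length len; configurations at times 0 … len)

cfg : Config → (ℕ → Config) → ℕ → Config
cfg c₀ nx zero    = c₀
cfg c₀ nx (suc t) = nx t

UsedUpTo : (ℕ → Config) → ℕ → Token → Set
UsedUpTo conf t k = ∃ λ s → s ≤ t × OccursTok k (conf s)

record Execution : Set₁ where
  field
    a₀ e₀  : Actor
    k₀ k₀' : Token
    a≢e    : a₀ ≢ e₀
    k≢k'   : k₀ ≢ k₀'
    len    : ℕ
    next   : ℕ → Config          -- next t is the configuration at time t+1
    ev     : ℕ → Event           -- ev t labels the transition t → t+1
    steps  : ∀ t → t < len →
      Step t (UsedUpTo (cfg (Init a₀ e₀ k₀ k₀') next) t)
           (cfg (Init a₀ e₀ k₀ k₀') next t) (ev t) (next t)

conf : Execution → ℕ → Config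
conf E = cfg (Init (Execution.a₀ E) (Execution.e₀ E) (Execution.k₀ E) (Execution.k₀' E))
             (Execution.next E)

KnowsIn : Maybe (Knowledge × Status) → Fact → Set
KnowsIn nothing        φ = ⊥
KnowsIn (just (Φ , _)) φ = Φ ⊢ φ

-- Derives E t A φ  means  α_t(A) ⊢ φ  (in particular A is internal at t)
Derives : Execution → ℕ → Actor → Fact → Set
Derives E t A φ = KnowsIn (α (conf E t) A) φ

DeactivatedBefore : Execution → Refob → ℕ → Set
DeactivatedBefore E x t = ∃ λ s → s < t × Deactivates (Execution.ev E s) x

ReleasedBefore : Execution → Refob → ℕ → Set
ReleasedBefore E x t = ∃ λ s → s < t × Releases (Execution.ev E s) x

PendingAlong : Execution → Refob → ℕ → ℕ → TMsg → Set
PendingAlong E x t₁ t₂ m =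
  (∃ λ s → s < t₁ × ∃ λ A → Emits (Execution.ev E s) A m)
  × along (body m) ≡ x
  × ¬ (∃ λ r → r < t₂ × Consumes (Execution.ev E r) m)

HasCard : {A : Set} → (A → Set) → ℕ → Set
HasCard {A} P k = Σ (List A) λ L → Unique L × (∀ a → (a ∈ L) ⇔ P a) × length L ≡ k

module Submission where

-- A per-transition analysis first: every rule acts on the mailbox in
-- one of three ways (MailboxEffect), and on the knowledge of each actor
-- either by an evolution that increments exactly the counts of the refobs
-- the transition sends or receives along (Evolves) or by creating an actor
-- with pristine knowledge (Origin).  Induction along the execution then
-- gives invariants of the configuration at every time t: derivable send
-- and receive counts equal the numbers of messages sent and received along
-- the refob before t (SentCounts, RecvCounts); μ holds, without duplicates,
-- exactly the messages emitted and not consumed before t (Mailbox); and for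
-- an unreleased refob with internal target, the messages in μ plus those
-- received make up all those sent (InFlight).  The messages pending between
-- t₁ and t₂ are those along x in μ at t₂ together with those sent along x
-- during [t₂, t₁); counting them with the invariants gives n ∸ m.

open import Defs
open import Data.Bool using (true; false; T)
open import Data.Empty using (⊥; ⊥-elim)
open import Data.Unit using (tt)
open import Data.Nat using (ℕ; zero; suc; _+_; _∸_; _≤_; _<_; z≤n; s≤s; _≟_; _≡ᵇ_; _≤?_; _<?_)
open import Data.Nat.Properties using (≡ᵇ⇒≡; ≡⇒≡ᵇ; +-identityʳ; +-comm; +-suc; +-assoc; +-monoʳ-≤; +-monoʳ-<)
open import Data.Nat.Properties using (m≤m+n; n≤1+n; n<1+n; m<n⇒m<1+n; ≤-pred; ≤-trans; <-trans; <-≤-trans; ≤-<-trans)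
open import Data.Nat.Properties using (<⇒≤; <⇒≢; <⇒≱; ≰⇒>; ≮⇒≥; m≤n⇒m<n∨m≡n; m≤n⇒m∸n≡0; m+[n∸m]≡n; m+n∸n≡m)
open import Data.Nat.Tactic.RingSolver using (solve-∀)
open import Data.Maybe using (Maybe; just; nothing)
open import Data.Maybe.Properties using (just-injective)
open import Data.Product using (Σ; ∃; _×_; _,_; proj₁; proj₂)
open import Data.Sum using (_⊎_; inj₁; inj₂; [_,_])
open import Data.List using (List; []; _∷_; _++_; map; length; filter; fromMaybe)
open import Data.List.Properties using (filter-accept; filter-reject; length-++; filter-++; filter-none)
open import Data.List.Membership.Propositional using (_∈_)
open import Data.List.Membership.Propositional.Properties using (∈-++⁻; ∈-++⁺ˡ; ∈-++⁺ʳ; ∈-filter⁻; ∈-filter⁺)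
open import Data.List.Relation.Unary.Any using (here; there)
open import Data.List.Relation.Unary.All using (All; []; _∷_)
import Data.List.Relation.Unary.All as All
open import Data.List.Relation.Unary.AllPairs using ([]; _∷_)
open import Data.List.Relation.Unary.Unique.Propositional using (Unique)
open import Data.List.Relation.Unary.Unique.Propositional.Properties using (Unique[x∷xs]⇒x∉xs; ++⁺; filter⁺)
open import Data.List.Relation.Binary.Permutation.Propositional using (_↭_; prep; swap; ↭-sym)
import Data.List.Relation.Binary.Permutation.Propositional as ↭
open import Data.List.Relation.Binary.Permutation.Propositional.Properties using (shift; All-resp-↭; ∈-resp-↭; ↭-length; filter-↭)
open import Relation.Nullary using (¬_; yes; no; does)
open import Relation.Unary using (Decidable)
open import Relation.Binary.Definitions using (DecidableEquality)
open import Relation.Binary.PropositionalEquality using (_≡_; _≢_; refl; sym; trans; cong; cong₂; subst; module ≡-Reasoning)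
open import Function.Bundles using (_⇔_; mk⇔)

open ≡-Reasoning

_≟R_ : DecidableEquality Refob
(k ∶ a ⇒ b) ≟R (k' ∶ a' ⇒ b') with k ≟ k' | a ≟ a' | b ≟ b'
... | yes refl | yes refl | yes refl = yes refl
... | no k≢k'  | _        | _        = no λ { refl → k≢k' refl }
... | yes _    | no a≢a'  | _        = no λ { refl → a≢a' refl }
... | yes _    | yes _    | no b≢b'  = no λ { refl → b≢b' refl }

-- Case distinction on refobs (without abstracting over the decision procedure).
same-or-distinct : (x y : Refob) → x ≡ y ⊎ x ≢ y
same-or-distinct x y with x ≟R y
... | yes x≡y = inj₁ x≡y
... | no x≢y  = inj₂ x≢y

Along : Refob → TMsg → Set
Along y m = along (body m) ≡ y

along? : (y : Refob) → Decidable (Along y)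
along? y m = along (body m) ≟R y

countIn : {A : Set} {P : A → Set} → Decidable P → Maybe A → ℕ
countIn P? mx = length (filter P? (fromMaybe mx))

countIn-hit : {A : Set} {P : A → Set} (P? : Decidable P) {a : A} → P a → countIn P? (just a) ≡ 1
countIn-hit P? pa = cong length (filter-accept P? pa)

countIn-miss : {A : Set} {P : A → Set} (P? : Decidable P) {a : A} → ¬ P a → countIn P? (just a) ≡ 0
countIn-miss P? ¬pa = cong length (filter-reject P? ¬pa)

count-∷ : {A : Set} {P : A → Set} (P? : Decidable P) (x : A) (xs : List A) →
  length (filter P? (x ∷ xs)) ≡ countIn P? (just x) + length (filter P? xs)
count-∷ P? x xs with does (P? x)
... | true  = refl
... | false = refl

∈-fromMaybe : {A : Set} {x : A} (mx : Maybe A) → x ∈ fromMaybe mx → mx ≡ just x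
∈-fromMaybe (just _) (here refl) = refl

emitted : Event → Maybe TMsg
emitted (eSend _ m)        = just m
emitted (eSendInfo _ m)    = just m
emitted (eSendRelease _ m) = just m
emitted (eIn _ m)          = just m
emitted _                  = nothing

received : Event → Maybe Refob
received (eReceive _ ⟨ _ , app x _ ⟩)  = just x
received (eInfo _ ⟨ _ , info y _ _ ⟩) = just y
received _                            = nothing

sentAlong recvAlong : Refob → Event → ℕ
sentAlong y e = countIn (along? y) (emitted e)
recvAlong y e = countIn (_≟R y) (received e)

sentAlong-hit : ∀ e {m} → emitted e ≡ just m → sentAlong (along (body m)) e ≡ 1
sentAlong-hit e {m} em = trans (cong (countIn (along? _)) em) (countIn-hit (along? _) {m} refl)

sentAlong-miss : ∀ e {m y} → emitted e ≡ just m → along (body m) ≢ y → sentAlong y e ≡ 0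
sentAlong-miss e {m} {y} em ne = trans (cong (countIn (along? y)) em) (countIn-miss (along? y) {m} ne)

recvAlong-hit : ∀ e {x} → received e ≡ just x → recvAlong x e ≡ 1
recvAlong-hit e {x} rc = trans (cong (countIn (_≟R x)) rc) (countIn-hit (_≟R x) {x} refl)

recvAlong-miss : ∀ e {x y} → received e ≡ just x → x ≢ y → recvAlong y e ≡ 0
recvAlong-miss e {x} {y} rc ne = trans (cong (countIn (_≟R y)) rc) (countIn-miss (_≟R y) {x} ne)

countIn-along : ∀ y m → countIn (along? y) (just m) ≡ countIn (_≟R y) (just (along (body m)))
countIn-along y m with same-or-distinct (along (body m)) y
... | inj₁ m≡y = trans (countIn-hit (along? y) {m} m≡y) (sym (countIn-hit (_≟R y) m≡y))
... | inj₂ m≢y = trans (countIn-miss (along? y) {m} m≢y) (sym (countIn-miss (_≟R y) m≢y))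

emitted-Emits : ∀ {e A m} → Emits e A m → emitted e ≡ just m
emitted-Emits em-send    = refl
emitted-Emits em-info    = refl
emitted-Emits em-release = refl
emitted-Emits em-in      = refl

emits-same : ∀ {e A A' m m'} → Emits e A m → Emits e A' m' → m ≡ m'
emits-same em em' = just-injective (trans (sym (emitted-Emits em)) (emitted-Emits em'))

both-emitted : ∀ {e m} → emitted e ≡ nothing → ¬ emitted e ≡ just m
both-emitted noEmit em with trans (sym noEmit) em
... | ()

no-emission : ∀ {e A m} → emitted e ≡ nothing → ¬ Emits e A m
no-emission noEmit em = both-emitted noEmit (emitted-Emits em)

consumes-unique : ∀ {e m m'} → Consumes e m → Consumes e m' → m ≡ m'
consumes-unique co-receive    co-receive    = refl
consumes-unique co-info       co-info       = refl
consumes-unique co-release    co-release    = refl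
consumes-unique co-out        co-out        = refl
consumes-unique co-releaseOut co-releaseOut = refl
consumes-unique co-infoOut    co-infoOut    = refl

upd-lookup : ∀ {S : Set₁} (f : Actor → Maybe S) A v B {w} →
  upd f A v B ≡ just w → (B ≡ A × v ≡ w) ⊎ (B ≢ A × f B ≡ just w)
upd-lookup f A v B eq with B ≡ᵇ A in b
... | true  = inj₁ (≡ᵇ⇒≡ B A (subst T (sym b) tt) , just-injective eq)
... | false = inj₂ ((λ B≡A → subst T b (≡⇒≡ᵇ B A B≡A)) , eq)

upd-defined : ∀ {S : Set₁} (f : Actor → Maybe S) A v B → IsJust (f B) → IsJust (upd f A v B)
upd-defined f A v B p with B ≡ᵇ A
... | true  = tt
... | false = p

isJust : ∀ {S : Set₁} {mx : Maybe S} {w} → mx ≡ just w → IsJust mx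
isJust refl = tt

fromIsJust : ∀ {S : Set₁} (mx : Maybe S) → IsJust mx → Σ S λ w → mx ≡ just w
fromIsJust (just w) _ = w , refl

SentFact RecvFact ReleasedFact : Refob → Fact → Set
SentFact y (SentCount x _)  = x ≡ y
SentFact y _                = ⊥
RecvFact y (RecvCount x _)  = x ≡ y
RecvFact y _                = ⊥
ReleasedFact y (Released x) = x ≡ y
ReleasedFact y _            = ⊥

Agree : (Fact → Set) → Knowledge → Knowledge → Set
Agree P Φ Ψ = ∀ φ → P φ → (Φ φ → Ψ φ) × (Ψ φ → Φ φ)

agree-refl : ∀ {P Φ} → Agree P Φ Φ
agree-refl φ _ = (λ q → q) , (λ q → q)

agree-trans : ∀ {P Φ Ψ Θ} → Agree P Φ Ψ → Agree P Ψ Θ → Agree P Φ Θ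
agree-trans a b φ p = (λ q → proj₁ (b φ p) (proj₁ (a φ p) q)) , (λ q → proj₂ (a φ p) (proj₂ (b φ p) q))

agree-⊕ : ∀ {P : Fact → Set} {Φ φ} → ¬ P φ → Agree P Φ (Φ ⊕ φ)
agree-⊕ {P} ¬pφ ψ pψ = inj₁ , λ { (inj₁ q) → q ; (inj₂ refl) → ⊥-elim (¬pφ pψ) }

agree-⊖ : ∀ {P : Fact → Set} {Φ φ} → ¬ P φ → Agree P Φ (Φ ⊖ φ)
agree-⊖ {P} ¬pφ ψ pψ = (λ q → q , λ { refl → ¬pφ pψ }) , proj₁

agree-addAll : ∀ {A : Set} {P : Fact → Set} {Φ} (f : A → Fact) → (∀ a → ¬ P (f a)) →
  ∀ xs → Agree P Φ (addAll Φ (map f xs))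
agree-addAll {P = P} f ¬pf xs ψ pψ = inj₁ , λ { (inj₁ q) → q ; (inj₂ mem) → ⊥-elim (outside xs mem) }
  where
  outside : ∀ xs → ¬ ψ ∈ map f xs
  outside (a ∷ _)  (here refl) = ¬pf a pψ
  outside (_ ∷ xs) (there mem) = outside xs mem

agree-incSent : ∀ {P : Fact → Set} {Φ x n} → (∀ k → ¬ P (SentCount x k)) → Agree P Φ (incSent x n Φ)
agree-incSent ¬p = agree-trans (agree-⊖ (¬p _)) (agree-⊕ (¬p _))

agree-incRecv : ∀ {P : Fact → Set} {Φ x n} → (∀ k → ¬ P (RecvCount x k)) → Agree P Φ (incRecv x n Φ)
agree-incRecv ¬p = agree-trans (agree-⊖ (¬p _)) (agree-⊕ (¬p _))

agree-dropRecv : ∀ {P : Fact → Set} {Φ x} → (∀ k → ¬ P (RecvCount x k)) → Agree P Φ (dropRecv Φ x)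
agree-dropRecv ¬p ψ pψ = (λ q → q , λ { k refl → ¬p k pψ }) , proj₁

SentIs RecvIs : Knowledge → Refob → ℕ → Set
SentIs Φ y c = ∀ n → Φ ⊢ SentCount y n → n ≡ c
RecvIs Φ y c = ∀ n → Φ ⊢ RecvCount y n → n ≡ c

-- Derivations of counts only look at the count facts of y (and their absence).
sentIs-transfer : ∀ {Φ Ψ y c} → Agree (SentFact y) Φ Ψ → SentIs Φ y c → SentIs Ψ y c
sentIs-transfer ag h n (ax p)    = h n (ax (proj₂ (ag _ refl) p))
sentIs-transfer ag h n (sent0 f) = h n (sent0 λ k p → f k (proj₁ (ag _ refl) p))

recvIs-transfer : ∀ {Φ Ψ y c} → Agree (RecvFact y) Φ Ψ → RecvIs Φ y c → RecvIs Ψ y c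
recvIs-transfer ag h n (ax p)    = h n (ax (proj₂ (ag _ refl) p))
recvIs-transfer ag h n (recv0 f) = h n (recv0 λ k p → f k (proj₁ (ag _ refl) p))

sentIs-inc : ∀ {Φ Ψ y c n} → SentIs Φ y c → Φ ⊢ SentCount y n → Agree (SentFact y) Φ Ψ →
  SentIs (incSent y n Ψ) y (suc c)
sentIs-inc h d ag k (ax (inj₁ (p , k≢n))) =
  ⊥-elim (k≢n (cong (SentCount _) (trans (h _ (ax (proj₂ (ag _ refl) p))) (sym (h _ d)))))
sentIs-inc h d ag k (ax (inj₂ refl)) = cong suc (h _ d)
sentIs-inc h d ag k (sent0 f)        = ⊥-elim (f _ (inj₂ refl))

recvIs-inc : ∀ {Φ Ψ y c n} → RecvIs Φ y c → Φ ⊢ RecvCount y n → Agree (RecvFact y) Φ Ψ →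
  RecvIs (incRecv y n Ψ) y (suc c)
recvIs-inc h d ag k (ax (inj₁ (p , k≢n))) =
  ⊥-elim (k≢n (cong (RecvCount _) (trans (h _ (ax (proj₂ (ag _ refl) p))) (sym (h _ d)))))
recvIs-inc h d ag k (ax (inj₂ refl)) = cong suc (h _ d)
recvIs-inc h d ag k (recv0 f)        = ⊥-elim (f _ (inj₂ refl))

-- A knowledge set with no counts and no Released facts: that of a newly
-- created actor (the initial actor, or an actor after Spawn).
record Pristine (Φ : Knowledge) : Set where
  field
    noSent     : ∀ y → SentIs Φ y 0
    noRecv     : ∀ y → RecvIs Φ y 0
    noReleased : ∀ y → ¬ Φ (Released y)

data Plain : Fact → Set where
  created   : ∀ {x} → Plain (Created x)
  activated : ∀ {x} → Plain (Activated x)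

pristine : ∀ {Φ} → (∀ {φ} → Φ φ → Plain φ) → Pristine Φ
pristine {Φ} plain = record { noSent = noSent ; noRecv = noRecv ; noReleased = noReleased }
  where
  noSent : ∀ y → SentIs Φ y 0
  noSent _ _ (ax p) with plain p
  ... | ()
  noSent _ _ (sent0 _) = refl
  noRecv : ∀ y → RecvIs Φ y 0
  noRecv _ _ (ax p) with plain p
  ... | ()
  noRecv _ _ (recv0 _) = refl
  noReleased : ∀ y → ¬ Φ (Released y)
  noReleased _ p with plain p
  ... | ()

pristine-init : ∀ {a e k k'} → Pristine (initKnow a e k k')
pristine-init = pristine λ { (inj₁ refl) → activated ; (inj₂ (inj₁ refl)) → created ; (inj₂ (inj₂ refl)) → activated }

pristine-spawn : ∀ {A B k k'} → Pristine (spawnKnow A B k k')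
pristine-spawn = pristine λ { (inj₁ refl) → created ; (inj₂ (inj₁ refl)) → created ; (inj₂ (inj₂ refl)) → activated }

record Evolves (e : Event) (A : Actor) (Φ Φ' : Knowledge) : Set where
  field
    sent     : ∀ y c → own y ≡ A → ¬ Deactivates e y → SentIs Φ y c → SentIs Φ' y (c + sentAlong y e)
    recv     : ∀ y c → tgt y ≡ A → ¬ Φ (Released y) → RecvIs Φ y c → RecvIs Φ' y (c + recvAlong y e)
    released : ∀ y → ¬ Releases e y → Φ' (Released y) → Φ (Released y)

record Quiet (e : Event) (A : Actor) : Set where
  field
    sendsNothing    : ∀ y → own y ≡ A → sentAlong y e ≡ 0
    receivesNothing : ∀ y → tgt y ≡ A → recvAlong y e ≡ 0

plus-zero : ∀ {k} c → k ≡ 0 → c ≡ c + k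
plus-zero c refl = sym (+-identityʳ c)

plus-one : ∀ {k} c → k ≡ 1 → suc c ≡ c + k
plus-one c refl = sym (+-comm c 1)

quiet-evolves : ∀ {e A Φ} → Quiet e A → Evolves e A Φ Φ
quiet-evolves {Φ = Φ} q = record
  { sent     = λ y c oy _ h → subst (SentIs Φ y) (plus-zero c (sendsNothing y oy)) h
  ; recv     = λ y c ty _ h → subst (RecvIs Φ y) (plus-zero c (receivesNothing y ty)) h
  ; released = λ _ _ p → p
  }
  where open Quiet q

quiet-silent : ∀ {e A} → emitted e ≡ nothing → received e ≡ nothing → Quiet e A
quiet-silent {e} em rc = record
  { sendsNothing    = λ y _ → cong (countIn (along? y)) em
  ; receivesNothing = λ y _ → cong (countIn (_≟R y)) rc }

quiet-sender : ∀ {e m A} → emitted e ≡ just m → received e ≡ nothing → A ≢ own (along (body m)) → Quiet e A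
quiet-sender {e} em rc A≢owner = record
  { sendsNothing    = λ y oy → sentAlong-miss e em λ al → A≢owner (trans (sym oy) (cong own (sym al)))
  ; receivesNothing = λ y _ → cong (countIn (_≟R y)) rc }

quiet-receiver : ∀ {e x A} → emitted e ≡ nothing → received e ≡ just x → A ≢ tgt x → Quiet e A
quiet-receiver {e} em rc A≢tgt = record
  { sendsNothing    = λ y _ → cong (countIn (along? y)) em
  ; receivesNothing = λ y ty → recvAlong-miss e rc λ x≡y → A≢tgt (trans (sym ty) (cong tgt (sym x≡y))) }

released-from : ∀ {Φ Ψ y} → Agree (ReleasedFact y) Φ Ψ → Ψ (Released y) → Φ (Released y)
released-from ag = proj₂ (ag _ refl)

sent-same : ∀ e {Φ Ψ y c} → sentAlong y e ≡ 0 → Agree (SentFact y) Φ Ψ →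
  SentIs Φ y c → SentIs Ψ y (c + sentAlong y e)
sent-same _ {Ψ = Ψ} {y} {c} z ag h = subst (SentIs Ψ y) (plus-zero c z) (sentIs-transfer ag h)

recv-same : ∀ e {Φ Ψ y c} → recvAlong y e ≡ 0 → Agree (RecvFact y) Φ Ψ →
  RecvIs Φ y c → RecvIs Ψ y (c + recvAlong y e)
recv-same _ {Ψ = Ψ} {y} {c} z ag h = subst (RecvIs Ψ y) (plus-zero c z) (recvIs-transfer ag h)

sent-next : ∀ e {Φ Ψ₀ Ψ y c n} → sentAlong y e ≡ 1 → SentIs Φ y c → Φ ⊢ SentCount y n →
  Agree (SentFact y) Φ Ψ₀ → Agree (SentFact y) (incSent y n Ψ₀) Ψ → SentIs Ψ y (c + sentAlong y e)
sent-next _ {Ψ = Ψ} {y} {c} o h d ag ag' = subst (SentIs Ψ y) (plus-one c o) (sentIs-transfer ag' (sentIs-inc h d ag))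

recv-next : ∀ e {Φ Ψ₀ Ψ y c n} → recvAlong y e ≡ 1 → RecvIs Φ y c → Φ ⊢ RecvCount y n →
  Agree (RecvFact y) Φ Ψ₀ → Agree (RecvFact y) (incRecv y n Ψ₀) Ψ → RecvIs Ψ y (c + recvAlong y e)
recv-next _ {Ψ = Ψ} {y} {c} o h d ag ag' = subst (RecvIs Ψ y) (plus-one c o) (recvIs-transfer ag' (recvIs-inc h d ag))

evolves-spawn : ∀ {Φ A B k} → Evolves (eSpawn A B) A Φ (Φ ⊕ Activated (k ∶ A ⇒ B))
evolves-spawn {Φ} {A} {B} = record
  { sent     = λ _ _ _ _ → sent-same (eSpawn A B) refl (agree-⊕ λ ())
  ; recv     = λ _ _ _ _ → recv-same (eSpawn A B) refl (agree-⊕ λ ())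
  ; released = λ _ _ → released-from {Φ} (agree-⊕ λ ())
  }

evolves-send : ∀ {Φ A B kx n t} (ys : List Triple) → Φ ⊢ SentCount (kx ∶ A ⇒ B) n →
  Evolves (eSend A ⟨ t , app (kx ∶ A ⇒ B) (map (newRef B) ys) ⟩) A Φ
          (addAll (incSent (kx ∶ A ⇒ B) n Φ) (map (cuFact A B) ys))
evolves-send {Φ} {A} {B} {kx} {n} {t} ys d = record
  { sent     = sent
  ; recv     = λ _ _ _ _ → recv-same e refl (agree-trans (agree-incSent λ _ ()) (addCU λ { (_ , _ , _) () }))
  ; released = λ _ _ → released-from {Φ} (agree-trans (agree-incSent λ _ ()) (addCU λ { (_ , _ , _) () }))
  }
  where
  x = kx ∶ A ⇒ B
  e = eSend A ⟨ t , app x (map (newRef B) ys) ⟩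
  addCU : ∀ {P Ψ} → (∀ a → ¬ P (cuFact A B a)) → Agree P Ψ (addAll Ψ (map (cuFact A B) ys))
  addCU ¬p = agree-addAll (cuFact A B) ¬p ys
  sent : ∀ y c → own y ≡ A → ¬ Deactivates e y → SentIs Φ y c →
    SentIs (addAll (incSent x n Φ) (map (cuFact A B) ys)) y (c + sentAlong y e)
  sent y c _ _ h with same-or-distinct x y
  ... | inj₁ refl = sent-next e (sentAlong-hit e refl) h d agree-refl (addCU λ { (_ , _ , _) () })
  ... | inj₂ x≢y = sent-same e (sentAlong-miss e refl x≢y)
                             (agree-trans (agree-incSent λ _ → x≢y) (addCU λ { (_ , _ , _) () })) h

evolves-receive : ∀ {Φ B s x R n} → Φ ⊢ RecvCount x n →
  Evolves (eReceive B ⟨ s , app x R ⟩) B Φ (addAll (incRecv x n Φ) (map Activated R))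
evolves-receive {Φ} {B} {s} {x} {R} {n} d = record
  { sent     = λ _ _ _ _ → sent-same e refl (agree-trans (agree-incRecv λ _ ()) (addAct λ ()))
  ; recv     = recv
  ; released = λ _ _ → released-from {Φ} (agree-trans (agree-incRecv λ _ ()) (addAct λ ()))
  }
  where
  e = eReceive B ⟨ s , app x R ⟩
  addAct : ∀ {P Ψ} → (∀ {z} → ¬ P (Activated z)) → Agree P Ψ (addAll Ψ (map Activated R))
  addAct ¬p = agree-addAll Activated (λ _ → ¬p) R
  recv : ∀ y c → tgt y ≡ B → ¬ Φ (Released y) → RecvIs Φ y c →
    RecvIs (addAll (incRecv x n Φ) (map Activated R)) y (c + recvAlong y e)
  recv y c _ _ h with same-or-distinct x y
  ... | inj₁ refl = recv-next e (recvAlong-hit e refl) h d agree-refl (addAct λ ())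
  ... | inj₂ x≢y = recv-same e (recvAlong-miss e refl x≢y)
                             (agree-trans (agree-incRecv λ _ → x≢y) (addAct λ ())) h

evolves-sendInfo : ∀ {Φ A B Cc ky kz n t} → Φ ⊢ SentCount (ky ∶ A ⇒ Cc) n →
  Evolves (eSendInfo A ⟨ t , info (ky ∶ A ⇒ Cc) (kz ∶ B ⇒ Cc) B ⟩) A Φ
          (incSent (ky ∶ A ⇒ Cc) n (Φ ⊖ CreatedUsing (ky ∶ A ⇒ Cc) (kz ∶ B ⇒ Cc)))
evolves-sendInfo {Φ} {A} {B} {Cc} {ky} {kz} {n} {t} d = record
  { sent     = sent
  ; recv     = λ _ _ _ _ → recv-same e refl (agree-trans (agree-⊖ λ ()) (agree-incSent λ _ ()))
  ; released = λ _ _ → released-from {Φ} (agree-trans (agree-⊖ λ ()) (agree-incSent λ _ ()))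
  }
  where
  x = ky ∶ A ⇒ Cc
  e = eSendInfo A ⟨ t , info x (kz ∶ B ⇒ Cc) B ⟩
  sent : ∀ y c → own y ≡ A → ¬ Deactivates e y → SentIs Φ y c →
    SentIs (incSent x n (Φ ⊖ CreatedUsing x (kz ∶ B ⇒ Cc))) y (c + sentAlong y e)
  sent y c _ _ h with same-or-distinct x y
  ... | inj₁ refl = sent-next e (sentAlong-hit e refl) h d (agree-⊖ λ ()) agree-refl
  ... | inj₂ x≢y = sent-same e (sentAlong-miss e refl x≢y)
                             (agree-trans (agree-⊖ λ ()) (agree-incSent λ _ → x≢y)) h

evolves-info : ∀ {Φ Cc s y z B n} → Φ ⊢ RecvCount y n →
  Evolves (eInfo Cc ⟨ s , info y z B ⟩) Cc Φ (incRecv y n Φ ⊕ Created z)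
evolves-info {Φ} {Cc} {s} {x} {z} {B} {n} d = record
  { sent     = λ _ _ _ _ → sent-same e refl (agree-trans (agree-incRecv λ _ ()) (agree-⊕ λ ()))
  ; recv     = recv
  ; released = λ _ _ → released-from {Φ} (agree-trans (agree-incRecv λ _ ()) (agree-⊕ λ ()))
  }
  where
  e = eInfo Cc ⟨ s , info x z B ⟩
  recv : ∀ y c → tgt y ≡ Cc → ¬ Φ (Released y) → RecvIs Φ y c →
    RecvIs (incRecv x n Φ ⊕ Created z) y (c + recvAlong y e)
  recv y c _ _ h with same-or-distinct x y
  ... | inj₁ refl = recv-next e (recvAlong-hit e refl) h d agree-refl (agree-⊕ λ ())
  ... | inj₂ x≢y = recv-same e (recvAlong-miss e refl x≢y)
                             (agree-trans (agree-incRecv λ _ → x≢y) (agree-⊕ λ ())) h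

-- SendRelease deactivates x, so the send count of x is no longer tracked.
evolves-sendRelease : ∀ {Φ A B kx n t} →
  Evolves (eSendRelease A ⟨ t , release (kx ∶ A ⇒ B) n ⟩) A Φ
          ((Φ ⊖ Activated (kx ∶ A ⇒ B)) ⊖ SentCount (kx ∶ A ⇒ B) n)
evolves-sendRelease {Φ} {A} {B} {kx} {n} {t} = record
  { sent     = sent
  ; recv     = λ _ _ _ _ → recv-same e refl (agree-trans (agree-⊖ λ ()) (agree-⊖ λ ()))
  ; released = λ _ _ → released-from {Φ} (agree-trans (agree-⊖ λ ()) (agree-⊖ λ ()))
  }
  where
  x = kx ∶ A ⇒ B
  e = eSendRelease A ⟨ t , release x n ⟩
  sent : ∀ y c → own y ≡ A → ¬ Deactivates e y → SentIs Φ y c →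
    SentIs ((Φ ⊖ Activated x) ⊖ SentCount x n) y (c + sentAlong y e)
  sent y c _ ¬deact h with same-or-distinct x y
  ... | inj₁ refl = ⊥-elim (¬deact deact)
  ... | inj₂ x≢y = sent-same e (sentAlong-miss e refl x≢y) (agree-trans (agree-⊖ λ ()) (agree-⊖ x≢y)) h

evolves-release : ∀ {Φ B s x n} → Evolves (eRelease B ⟨ s , release x n ⟩) B Φ (Φ ⊕ Released x)
evolves-release {Φ} {B} {s} {x} {n} = record
  { sent     = λ _ _ _ _ → sent-same e refl (agree-⊕ λ ())
  ; recv     = λ _ _ _ _ → recv-same e refl (agree-⊕ λ ())
  ; released = released
  }
  where
  e = eRelease B ⟨ s , release x n ⟩
  released : ∀ y → ¬ Releases e y → (Φ ⊕ Released x) (Released y) → Φ (Released y)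
  released y ¬rel with same-or-distinct x y
  ... | inj₁ refl = ⊥-elim (¬rel rel)
  ... | inj₂ x≢y = released-from {Φ} (agree-⊕ x≢y)

-- Compaction only forgets the receive count of a refob already released.
evolves-compaction : ∀ {Φ Cc x} → Φ (Released x) →
  Evolves (eCompaction Cc x) Cc Φ (dropRecv ((Φ ⊖ Created x) ⊖ Released x) x)
evolves-compaction {Φ} {Cc} {x} relx = record
  { sent     = λ _ _ _ _ → sent-same e refl
                 (agree-trans (agree-trans (agree-⊖ λ ()) (agree-⊖ λ ())) (agree-dropRecv λ _ ()))
  ; recv     = recv
  ; released = λ _ _ p → proj₁ (proj₁ (proj₁ p))
  }
  where
  e = eCompaction Cc x
  recv : ∀ y c → tgt y ≡ Cc → ¬ Φ (Released y) → RecvIs Φ y c →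
    RecvIs (dropRecv ((Φ ⊖ Created x) ⊖ Released x) x) y (c + recvAlong y e)
  recv y c _ ¬rely h with same-or-distinct x y
  ... | inj₁ refl = ⊥-elim (¬rely relx)
  ... | inj₂ x≢y = recv-same e refl
                     (agree-trans (agree-trans (agree-⊖ λ ()) (agree-⊖ λ ())) (agree-dropRecv λ _ → x≢y)) h

data Origin (C : Config) (e : Event) (A : Actor) (Φ' : Knowledge) : Set₁ where
  old : ∀ {Φ s} → α C A ≡ just (Φ , s) → (¬ χ C A → Evolves e A Φ Φ') → Origin C e A Φ'
  new : ¬ Internal C A → ¬ χ C A → Pristine Φ' → Origin C e A Φ'

viaUpdate : ∀ {C e A₀ Φ₀ s₀ Ψ s A Φ' s'} → α C A₀ ≡ just (Φ₀ , s₀) → Evolves e A₀ Φ₀ Ψ →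
  (∀ {A} → A ≢ A₀ → Quiet e A) → upd (α C) A₀ (Ψ , s) A ≡ just (Φ' , s') → Origin C e A Φ'
viaUpdate {C} {A₀ = A₀} {Ψ = Ψ} {s} {A} eq ev quiet look with upd-lookup (α C) A₀ (Ψ , s) A look
... | inj₁ (refl , refl) = old eq λ _ → ev
... | inj₂ (A≢A₀ , eq') = old eq' λ _ → quiet-evolves (quiet A≢A₀)

unchanged : ∀ {C e A Φ s} → (¬ χ C A → Quiet e A) → α C A ≡ just (Φ , s) → Origin C e A Φ
unchanged quiet eq = old eq λ ¬χ → quiet-evolves (quiet ¬χ)

stepOrigin : ∀ {t U C e C' A Φ' s'} → Step t U C e C' → α C' A ≡ just (Φ' , s') → Origin C e A Φ'
stepOrigin {C = C} {A = A} (spawn {Φ = Φ} {A = A₀} {B} {k} {k'} eq ¬int ¬ext _ _ _) look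
  with upd-lookup (upd (α C) A₀ (Φ ⊕ Activated (k ∶ A₀ ⇒ B) , busy)) B (spawnKnow A₀ B k k' , busy) A look
... | inj₁ (refl , refl) = new ¬int ¬ext pristine-spawn
... | inj₂ (_ , look')   = viaUpdate eq evolves-spawn (λ _ → quiet-silent refl refl) look'
stepOrigin (send ys eq _ _ _ _ d) look = viaUpdate eq (evolves-send ys d) (quiet-sender refl refl) look
stepOrigin (receive eq _ tx d) look =
  viaUpdate eq (evolves-receive d) (λ A≢B → quiet-receiver refl refl λ A≡tx → A≢B (trans A≡tx tx)) look
stepOrigin (idleR eq) look = viaUpdate eq (quiet-evolves (quiet-silent refl refl)) (λ _ → quiet-silent refl refl) look
stepOrigin (sendInfo eq _ d) look = viaUpdate eq (evolves-sendInfo d) (quiet-sender refl refl) look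
stepOrigin (infoR eq _ ty d) look =
  viaUpdate eq (evolves-info d) (λ A≢C → quiet-receiver refl refl λ A≡ty → A≢C (trans A≡ty ty)) look
stepOrigin (sendRelease eq _ _ _) look = viaUpdate eq evolves-sendRelease (quiet-sender refl refl) look
stepOrigin (releaseR eq _ _ _) look = viaUpdate eq evolves-release (λ _ → quiet-silent refl refl) look
stepOrigin (compaction eq _ _ relx) look = viaUpdate eq (evolves-compaction relx) (λ _ → quiet-silent refl refl) look
stepOrigin (snapshot _) look = unchanged (λ _ → quiet-silent refl refl) look
stepOrigin {C = C} (inR _ _ extE _ _ _ _) look =
  unchanged (λ ¬ext → quiet-sender refl refl λ A≡E → ¬ext (subst (χ C) (sym A≡E) extE)) look
stepOrigin (out _ _) look = unchanged (λ _ → quiet-silent refl refl) look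
stepOrigin (releaseOut _ _) look = unchanged (λ _ → quiet-silent refl refl) look
stepOrigin (infoOut _ _) look = unchanged (λ _ → quiet-silent refl refl) look

module _ {t : ℕ} {U : Token → Set} where

  stepKeepsInternal : ∀ {C e C' D} → Step t U C e C' → Internal C D → Internal C' D
  stepKeepsInternal {C} {D = D} (spawn {Φ = Φ} {A = A} {B} {k} {k'} _ _ _ _ _ _) p =
    upd-defined (upd (α C) A spawner) B (spawnKnow A B k k' , busy) D (upd-defined (α C) A spawner D p)
    where spawner = Φ ⊕ Activated (k ∶ A ⇒ B) , busy
  stepKeepsInternal {C} {D = D} (send {A = A} _ _ _ _ _ _ _) p = upd-defined (α C) A _ D p
  stepKeepsInternal {C} {D = D} (receive {B = B} _ _ _ _)    p = upd-defined (α C) B _ D p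
  stepKeepsInternal {C} {D = D} (idleR {A = A} _)            p = upd-defined (α C) A _ D p
  stepKeepsInternal {C} {D = D} (sendInfo {A = A} _ _ _)     p = upd-defined (α C) A _ D p
  stepKeepsInternal {C} {D = D} (infoR {Cc = Cc} _ _ _ _)    p = upd-defined (α C) Cc _ D p
  stepKeepsInternal {C} {D = D} (sendRelease {A = A} _ _ _ _) p = upd-defined (α C) A _ D p
  stepKeepsInternal {C} {D = D} (releaseR {B = B} _ _ _ _)   p = upd-defined (α C) B _ D p
  stepKeepsInternal {C} {D = D} (compaction {Cc = Cc} _ _ _ _) p = upd-defined (α C) Cc _ D p
  stepKeepsInternal (snapshot _)          p = p
  stepKeepsInternal (inR _ _ _ _ _ _ _)   p = p
  stepKeepsInternal (out _ _)             p = p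
  stepKeepsInternal (releaseOut _ _)      p = p
  stepKeepsInternal (infoOut _ _)         p = p

  ExternalStep : Config → Config → Set
  ExternalStep C C' = (∀ {D} → χ C D → χ C' D) × (∀ {D} → χ C' D → χ C D ⊎ ¬ Internal C' D)

  stepExternal : ∀ {C e C'} → Step t U C e C' → ExternalStep C C'
  stepExternal (spawn _ _ _ _ _ _)     = (λ p → p) , inj₁
  stepExternal (send _ _ _ _ _ _ _)    = (λ p → p) , inj₁
  stepExternal (receive _ _ _ _)       = (λ p → p) , inj₁
  stepExternal (idleR _)               = (λ p → p) , inj₁
  stepExternal (sendInfo _ _ _)        = (λ p → p) , inj₁
  stepExternal (infoR _ _ _ _)         = (λ p → p) , inj₁
  stepExternal (sendRelease _ _ _ _)   = (λ p → p) , inj₁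
  stepExternal (releaseR _ _ _ _)      = (λ p → p) , inj₁
  stepExternal (compaction _ _ _ _)    = (λ p → p) , inj₁
  stepExternal (snapshot _)            = (λ p → p) , inj₁
  stepExternal (inR _ _ _ _ _ _ _)     = inj₁ , λ { (inj₁ p) → inj₁ p ; (inj₂ (_ , ¬int)) → inj₂ ¬int }
  stepExternal (out _ _)               = (λ p → p) , inj₁
  stepExternal (releaseOut _ _)        = (λ p → p) , inj₁
  stepExternal (infoOut _ _)           = (λ p → p) , inj₁

data Consumption (C : Config) (e : Event) (m : TMsg) : Set where
  receipt  : received e ≡ just (along (body m)) → Internal C (tgt (along (body m))) → Consumption C e m
  disposal : received e ≡ nothing → Releases e (along (body m)) ⊎ χ C (tgt (along (body m))) → Consumption C e m

data MailboxEffect (t : ℕ) (C C' : Config) (e : Event) : Set₁ where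
  emits : ∀ m → Emits e (own (along (body m))) m → received e ≡ nothing → (∀ {x} → ¬ Consumes e x) →
    tag m ≡ t → Internal C (own (along (body m))) ⊎ χ C (own (along (body m))) →
    μ C' ≡ m ∷ μ C → MailboxEffect t C C' e
  consumes : ∀ m → Consumes e m → emitted e ≡ nothing → μ C ↭ m ∷ μ C' → Consumption C e m →
    MailboxEffect t C C' e
  silent : emitted e ≡ nothing → received e ≡ nothing → (∀ {x} → ¬ Consumes e x) → μ C' ≡ μ C →
    MailboxEffect t C C' e

removal : ∀ (μ₁ : List TMsg) {μ₂ μ' m} → μ' ≡ μ₁ ++ m ∷ μ₂ → μ' ↭ m ∷ μ₁ ++ μ₂
removal μ₁ {μ₂} {m = m} refl = shift m μ₁ μ₂

stepMailbox : ∀ {t U C e C'} → Step t U C e C' → MailboxEffect t C C' e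
stepMailbox (spawn _ _ _ _ _ _)          = silent refl refl (λ ()) refl
stepMailbox (send _ eq _ _ _ _ _)        = emits _ em-send refl (λ ()) refl (inj₁ (isJust eq)) refl
stepMailbox {C = C} (receive {μ₁ = μ₁} eq mq tx _) =
  consumes _ co-receive refl (removal μ₁ mq) (receipt refl (subst (Internal C) (sym tx) (isJust eq)))
stepMailbox (idleR _)                    = silent refl refl (λ ()) refl
stepMailbox (sendInfo eq _ _)            = emits _ em-info refl (λ ()) refl (inj₁ (isJust eq)) refl
stepMailbox {C = C} (infoR {μ₁ = μ₁} eq mq ty _) =
  consumes _ co-info refl (removal μ₁ mq) (receipt refl (subst (Internal C) (sym ty) (isJust eq)))
stepMailbox (sendRelease eq _ _ _)       = emits _ em-release refl (λ ()) refl (inj₁ (isJust eq)) refl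
stepMailbox (releaseR {μ₁ = μ₁} _ mq _ _) = consumes _ co-release refl (removal μ₁ mq) (disposal refl (inj₁ rel))
stepMailbox (compaction _ _ _ _)         = silent refl refl (λ ()) refl
stepMailbox (snapshot _)                 = silent refl refl (λ ()) refl
stepMailbox (inR _ _ extE _ _ _ _)       = emits _ em-in refl (λ ()) refl (inj₂ extE) refl
stepMailbox (out {μ₁ = μ₁} mq ext)        = consumes _ co-out refl (removal μ₁ mq) (disposal refl (inj₂ ext))
stepMailbox (releaseOut {μ₁ = μ₁} mq ext) =
  consumes _ co-releaseOut refl (removal μ₁ mq) (disposal refl (inj₂ ext))
stepMailbox (infoOut {μ₁ = μ₁} mq ext)    = consumes _ co-infoOut refl (removal μ₁ mq) (disposal refl (inj₂ ext))

unique-resp-↭ : ∀ {A : Set} {xs ys : List A} → xs ↭ ys → Unique xs → Unique ys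
unique-resp-↭ ↭.refl u = u
unique-resp-↭ (prep x p) (x∉ ∷ u) = All-resp-↭ p x∉ ∷ unique-resp-↭ p u
unique-resp-↭ (swap x y p) ((x≢y ∷ x∉) ∷ y∉ ∷ u) =
  ((λ y≡x → x≢y (sym y≡x)) ∷ All-resp-↭ p y∉) ∷ All-resp-↭ p x∉ ∷ unique-resp-↭ p u
unique-resp-↭ (↭.trans p q) u = unique-resp-↭ q (unique-resp-↭ p u)

total : (ℕ → ℕ) → ℕ → ℕ
total f zero    = 0
total f (suc t) = total f t + f t

total-zero : ∀ f t → (∀ s → s < t → f s ≡ 0) → total f t ≡ 0
total-zero f zero    _ = refl
total-zero f (suc t) z = cong₂ _+_ (total-zero f t λ s s<t → z s (m<n⇒m<1+n s<t)) (z t (n<1+n t))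

Before : (ℕ → Set) → ℕ → Set
Before P t = ∃ λ s → s < t × P s

below-suc : ∀ {s t} → s < suc t → s < t ⊎ s ≡ t
below-suc s<1+t = m≤n⇒m<n∨m≡n (≤-pred s<1+t)

before-mono : ∀ {P s t} → s ≤ t → Before P s → Before P t
before-mono s≤t (r , r<s , p) = r , <-≤-trans r<s s≤t , p

before-weaken : ∀ {P t} → Before P t → Before P (suc t)
before-weaken {t = t} = before-mono (n≤1+n t)

before-now : ∀ {P t} → P t → Before P (suc t)
before-now {t = t} p = t , n<1+n t , p

before-split : ∀ {P t} → Before P (suc t) → Before P t ⊎ P t
before-split (s , s<1+t , p) with below-suc s<1+t
... | inj₁ s<t  = inj₁ (s , s<t , p)
... | inj₂ refl = inj₂ p

not-before-suc : ∀ {P t} → ¬ Before P (suc t) → ¬ Before P t × ¬ P t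
not-before-suc never = (λ b → never (before-weaken b)) , (λ p → never (before-now p))

module Run (E : Execution) where
  open Execution E

  Cf : ℕ → Config
  Cf = conf E

  step : ∀ {t} → t < len → Step t (UsedUpTo Cf t) (Cf t) (ev t) (Cf (suc t))
  step {t} = steps t

  upTo : ∀ {ℓ} (P : ℕ → Set ℓ) → P 0 → (∀ {t} → t < len → P t → P (suc t)) → ∀ t → t ≤ len → P t
  upTo P base preserved zero    _     = base
  upTo P base preserved (suc t) t<len = preserved t<len (upTo P base preserved t (<⇒≤ t<len))

  persists : (P : ℕ → Set) → (∀ {t} → t < len → P t → P (suc t)) → ∀ {s t} → s ≤ t → t ≤ len → P s → P t
  persists P keep {t = zero}  z≤n  _     p = p
  persists P keep {s} {suc t} s≤t t<len p with m≤n⇒m<n∨m≡n s≤t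
  ... | inj₂ refl       = p
  ... | inj₁ (s≤s s≤t') = keep t<len (persists P keep s≤t' (<⇒≤ t<len) p)

  internalLater : ∀ {D s t} → s ≤ t → t ≤ len → Internal (Cf s) D → Internal (Cf t) D
  internalLater {D} = persists (λ t → Internal (Cf t) D) λ lt → stepKeepsInternal (step lt)

  externalLater : ∀ {D s t} → s ≤ t → t ≤ len → χ (Cf s) D → χ (Cf t) D
  externalLater {D} = persists (λ t → χ (Cf t) D) λ lt → proj₁ (stepExternal (step lt))

  sentBefore recvBefore : Refob → ℕ → ℕ
  sentBefore y = total λ s → sentAlong y (ev s)
  recvBefore y = total λ s → recvAlong y (ev s)

  Emitted Consumed : TMsg → ℕ → Set
  Emitted m  = Before λ s → ∃ λ A → Emits (ev s) A m
  Consumed m = Before λ r → Consumes (ev r) m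

  initialActor : ∀ {A Φ s} → α (Cf 0) A ≡ just (Φ , s) → A ≡ a₀ × Pristine Φ
  initialActor {A} look with upd-lookup (λ _ → nothing) a₀ (initKnow a₀ e₀ k₀ k₀' , busy) A look
  ... | inj₁ (A≡a₀ , refl) = A≡a₀ , pristine-init
  ... | inj₂ (_ , ())

  sentOnlyByKnown : ∀ {t A y} → t < len → ¬ Internal (Cf t) A → ¬ χ (Cf t) A → own y ≡ A →
    ∀ s → s < suc t → sentAlong y (ev s) ≡ 0
  sentOnlyByKnown {t} {y = y} t<len ¬int ¬ext oy s s≤t with stepMailbox (step (≤-<-trans (≤-pred s≤t) t<len))
  ... | consumes _ _ noEmit _ _ = cong (countIn (along? y)) noEmit
  ... | silent noEmit _ _ _     = cong (countIn (along? y)) noEmit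
  ... | emits m em _ _ _ known _ with same-or-distinct (along (body m)) y
  ...   | inj₂ m≢y  = sentAlong-miss (ev s) (emitted-Emits em) m≢y
  ...   | inj₁ refl = ⊥-elim ([ (λ int → ¬int (subst (Internal (Cf t)) oy (internalLater (≤-pred s≤t) (<⇒≤ t<len) int)))
                              , (λ ext → ¬ext (subst (χ (Cf t)) oy (externalLater (≤-pred s≤t) (<⇒≤ t<len) ext)))
                              ] known)

  recvOnlyByInternal : ∀ {t A y} → t < len → ¬ Internal (Cf t) A → tgt y ≡ A →
    ∀ s → s < suc t → recvAlong y (ev s) ≡ 0
  recvOnlyByInternal {t} {y = y} t<len ¬int ty s s≤t with stepMailbox (step (≤-<-trans (≤-pred s≤t) t<len))
  ... | emits _ _ noRecv _ _ _ _           = cong (countIn (_≟R y)) noRecv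
  ... | silent _ noRecv _ _                = cong (countIn (_≟R y)) noRecv
  ... | consumes _ _ _ _ (disposal noRecv _) = cong (countIn (_≟R y)) noRecv
  ... | consumes m _ _ _ (receipt rc int) with same-or-distinct (along (body m)) y
  ...   | inj₂ m≢y  = recvAlong-miss (ev s) rc m≢y
  ...   | inj₁ refl = ⊥-elim (¬int (subst (Internal (Cf t)) ty (internalLater (≤-pred s≤t) (<⇒≤ t<len) int)))

  Disjoint : Config → Set
  Disjoint C = ∀ {A} → Internal C A → ¬ χ C A

  disjointAt : ∀ t → t ≤ len → Disjoint (Cf t)
  disjointAt = upTo (λ t → Disjoint (Cf t)) base preserved
    where
    base : Disjoint (Cf 0)
    base int A≡e₀ with fromIsJust _ int
    ... | _ , look = a≢e (trans (sym (proj₁ (initialActor look))) A≡e₀)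
    preserved : ∀ {t} → t < len → Disjoint (Cf t) → Disjoint (Cf (suc t))
    preserved lt disj int ext with fromIsJust _ int
    ... | _ , look with stepOrigin (step lt) look | proj₂ (stepExternal (step lt)) ext
    ...   | _             | inj₂ ¬int  = ¬int int
    ...   | old eq _      | inj₁ ext₀  = disj (isJust eq) ext₀
    ...   | new _ ¬ext₀ _ | inj₁ ext₀  = ¬ext₀ ext₀

  SentCounts : ℕ → Set₁
  SentCounts t = ∀ {A Φ st y} → α (Cf t) A ≡ just (Φ , st) → own y ≡ A →
    ¬ DeactivatedBefore E y t → SentIs Φ y (sentBefore y t)

  sentCountsAt : ∀ t → t ≤ len → SentCounts t
  sentCountsAt = upTo SentCounts (λ {A} look _ _ → Pristine.noSent (proj₂ (initialActor {A} look)) _) preserved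
    where
    preserved : ∀ {t} → t < len → SentCounts t → SentCounts (suc t)
    preserved {t} lt counts {y = y} look oy notDeact with stepOrigin (step lt) look
    ... | old eq evolves =
      Evolves.sent (evolves (disjointAt t (<⇒≤ lt) (isJust eq))) y _ oy (proj₂ (not-before-suc notDeact))
        (counts eq oy (proj₁ (not-before-suc notDeact)))
    ... | new ¬int ¬ext pristine =
      subst (SentIs _ y) (sym (total-zero _ (suc t) (sentOnlyByKnown lt ¬int ¬ext oy))) (Pristine.noSent pristine y)

  NoReleased : ℕ → Set₁
  NoReleased t = ∀ {A Φ st y} → α (Cf t) A ≡ just (Φ , st) → ¬ ReleasedBefore E y t → ¬ Φ (Released y)

  noReleasedAt : ∀ t → t ≤ len → NoReleased t
  noReleasedAt = upTo NoReleased (λ {A} look _ → Pristine.noReleased (proj₂ (initialActor {A} look)) _) preserved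
    where
    preserved : ∀ {t} → t < len → NoReleased t → NoReleased (suc t)
    preserved {t} lt none {y = y} look notRel with stepOrigin (step lt) look
    ... | old eq evolves = λ relNow →
      none eq (proj₁ (not-before-suc notRel))
        (Evolves.released (evolves (disjointAt t (<⇒≤ lt) (isJust eq))) y (proj₂ (not-before-suc notRel)) relNow)
    ... | new _ _ pristine = Pristine.noReleased pristine y

  RecvCounts : ℕ → Set₁
  RecvCounts t = ∀ {A Φ st y} → α (Cf t) A ≡ just (Φ , st) → tgt y ≡ A →
    ¬ ReleasedBefore E y t → RecvIs Φ y (recvBefore y t)

  recvCountsAt : ∀ t → t ≤ len → RecvCounts t
  recvCountsAt = upTo RecvCounts (λ {A} look _ _ → Pristine.noRecv (proj₂ (initialActor {A} look)) _) preserved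
    where
    preserved : ∀ {t} → t < len → RecvCounts t → RecvCounts (suc t)
    preserved {t} lt counts {y = y} look ty notRel with stepOrigin (step lt) look
    ... | old eq evolves =
      Evolves.recv (evolves (disjointAt t (<⇒≤ lt) (isJust eq))) y _ ty
        (noReleasedAt t (<⇒≤ lt) eq (proj₁ (not-before-suc notRel))) (counts eq ty (proj₁ (not-before-suc notRel)))
    ... | new ¬int _ pristine =
      subst (RecvIs _ y) (sym (total-zero _ (suc t) (recvOnlyByInternal lt ¬int ty))) (Pristine.noRecv pristine y)

  tag-emitted : ∀ {s A m} → s < len → Emits (ev s) A m → tag m ≡ s
  tag-emitted lt em with stepMailbox (step lt)
  ... | emits _ em₀ _ _ tg _ _   = trans (cong tag (emits-same em em₀)) tg
  ... | consumes _ _ noEmit _ _  = ⊥-elim (no-emission noEmit em)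
  ... | silent noEmit _ _ _      = ⊥-elim (no-emission noEmit em)

  record Mailbox (t : ℕ) : Set₁ where
    field
      distinct : Unique (μ (Cf t))
      pending  : ∀ {m} → m ∈ μ (Cf t) → Emitted m t × ¬ Consumed m t
      complete : ∀ {m} → Emitted m t → ¬ Consumed m t → m ∈ μ (Cf t)
      causal   : ∀ {r m} → r < t → Consumes (ev r) m → Emitted m r

  module _ {t} (lt : t < len) (box : Mailbox t) where
    open Mailbox box

    causal-suc : (∀ {m} → Consumes (ev t) m → Emitted m t) →
      ∀ {r m} → r < suc t → Consumes (ev r) m → Emitted m r
    causal-suc now r<1+t c with below-suc r<1+t
    ... | inj₁ r<t  = causal r<t c
    ... | inj₂ refl = now c

    unconsumed-suc : (∀ {x} → ¬ Consumes (ev t) x) → ∀ {m} → ¬ Consumed m t → ¬ Consumed m (suc t)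
    unconsumed-suc noCons notYet c with before-split c
    ... | inj₁ before = notYet before
    ... | inj₂ now    = noCons now

    unemitted-now : emitted (ev t) ≡ nothing → ∀ {m} → Emitted m (suc t) → Emitted m t
    unemitted-now noEmit em with before-split em
    ... | inj₁ before   = before
    ... | inj₂ (_ , em') = ⊥-elim (no-emission noEmit em')

    afterEmit : ∀ {m₀ A} → Emits (ev t) A m₀ → (∀ {x} → ¬ Consumes (ev t) x) → tag m₀ ≡ t →
      μ (Cf (suc t)) ≡ m₀ ∷ μ (Cf t) → Mailbox (suc t)
    afterEmit {m₀} em₀ noCons tg μ' = record
      { distinct = subst Unique (sym μ') (All.tabulate (λ x∈μ m₀≡x → notYet (subst (_∈ _) (sym m₀≡x) x∈μ)) ∷ distinct)
      ; pending  = λ x∈μ' → pending' (subst (_ ∈_) μ' x∈μ')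
      ; complete = complete'
      ; causal   = causal-suc λ c → ⊥-elim (noCons c)
      }
      where
      fresh : ¬ Emitted m₀ t
      fresh (s , s<t , _ , em) = <⇒≢ s<t (trans (sym (tag-emitted (<-trans s<t lt) em)) tg)
      notYet : ¬ m₀ ∈ μ (Cf t)
      notYet m₀∈μ = fresh (proj₁ (pending m₀∈μ))
      neverConsumed : ¬ Consumed m₀ (suc t)
      neverConsumed c with before-split c
      ... | inj₁ (r , r<t , cr) = fresh (before-mono (<⇒≤ r<t) (causal r<t cr))
      ... | inj₂ now            = noCons now
      pending' : ∀ {x} → x ∈ m₀ ∷ μ (Cf t) → Emitted x (suc t) × ¬ Consumed x (suc t)
      pending' (here refl) = before-now (_ , em₀) , neverConsumed
      pending' (there x∈μ) = before-weaken (proj₁ (pending x∈μ)) , unconsumed-suc noCons (proj₂ (pending x∈μ))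
      complete' : ∀ {x} → Emitted x (suc t) → ¬ Consumed x (suc t) → x ∈ μ (Cf (suc t))
      complete' em notC with before-split em
      ... | inj₁ before   = subst (_ ∈_) (sym μ') (there (complete before λ c → notC (before-weaken c)))
      ... | inj₂ (_ , em') = subst (_ ∈_) (sym μ') (here (emits-same em' em₀))

    afterConsume : ∀ {m₀} → Consumes (ev t) m₀ → emitted (ev t) ≡ nothing →
      μ (Cf t) ↭ m₀ ∷ μ (Cf (suc t)) → Mailbox (suc t)
    afterConsume {m₀} c₀ noEmit perm = record
      { distinct = tail
      ; pending  = pending'
      ; complete = complete'
      ; causal   = causal-suc λ c → proj₁ (pending (∈-resp-↭ (↭-sym perm) (here (consumes-unique c c₀))))
      }
      where
      unique' : Unique (m₀ ∷ μ (Cf (suc t)))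
      unique' = unique-resp-↭ perm distinct
      tail : Unique (μ (Cf (suc t)))
      tail with unique' 
      ... | _ ∷ u = u
      removed : ¬ m₀ ∈ μ (Cf (suc t))
      removed = Unique[x∷xs]⇒x∉xs unique'
      pending' : ∀ {x} → x ∈ μ (Cf (suc t)) → Emitted x (suc t) × ¬ Consumed x (suc t)
      pending' x∈μ' with pending (∈-resp-↭ (↭-sym perm) (there x∈μ'))
      ... | em , notC =
        before-weaken em , λ c → [ notC , (λ now → removed (subst (_∈ _) (consumes-unique now c₀) x∈μ')) ] (before-split c)
      complete' : ∀ {x} → Emitted x (suc t) → ¬ Consumed x (suc t) → x ∈ μ (Cf (suc t))
      complete' em notC with ∈-resp-↭ perm (complete (unemitted-now noEmit em) λ c → notC (before-weaken c))
      ... | here refl = ⊥-elim (notC (before-now c₀))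
      ... | there x∈μ' = x∈μ'

    afterSilent : emitted (ev t) ≡ nothing → (∀ {x} → ¬ Consumes (ev t) x) →
      μ (Cf (suc t)) ≡ μ (Cf t) → Mailbox (suc t)
    afterSilent noEmit noCons μ' = record
      { distinct = subst Unique (sym μ') distinct
      ; pending  = λ x∈μ → let em , notC = pending (subst (_ ∈_) μ' x∈μ)
                           in  before-weaken em , unconsumed-suc noCons notC
      ; complete = λ em notC → subst (_ ∈_) (sym μ') (complete (unemitted-now noEmit em) λ c → notC (before-weaken c))
      ; causal   = causal-suc λ c → ⊥-elim (noCons c)
      }

  mailboxAt : ∀ t → t ≤ len → Mailbox t
  mailboxAt = upTo Mailbox initial preserved
    where
    initial : Mailbox 0
    initial = record { distinct = [] ; pending = λ () ; complete = λ { (_ , () , _) _ } ; causal = λ () }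
    preserved : ∀ {t} → t < len → Mailbox t → Mailbox (suc t)
    preserved lt box with stepMailbox (step lt)
    ... | emits _ em _ noCons tg _ μ'    = afterEmit lt box em noCons tg μ'
    ... | consumes _ c noEmit perm _     = afterConsume lt box c noEmit perm
    ... | silent noEmit _ noCons μ'      = afterSilent lt box noEmit noCons μ'

  alongIn : Refob → List TMsg → ℕ
  alongIn y ms = length (filter (along? y) ms)

  InFlight : ℕ → Set
  InFlight t = ∀ y → ¬ ReleasedBefore E y t → ¬ χ (Cf t) (tgt y) →
    alongIn y (μ (Cf t)) + recvBefore y t ≡ sentBefore y t

  inFlightAt : ∀ t → t ≤ len → InFlight t
  inFlightAt = upTo InFlight (λ _ _ _ → refl) preserved
    where
    rearrange-emit : ∀ k a r → (k + a) + (r + 0) ≡ (a + r) + k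
    rearrange-emit = solve-∀
    rearrange-consume : ∀ k a r → a + (r + k) ≡ ((k + a) + r) + 0
    rearrange-consume = solve-∀
    preserved : ∀ {t} → t < len → InFlight t → InFlight (suc t)
    preserved {t} lt flight y notRel notExt
      with stepMailbox (step lt) | flight y (proj₁ (not-before-suc notRel)) (λ ext → notExt (proj₁ (stepExternal (step lt)) ext))
    ... | emits m em noRecv _ _ _ μ' | ih =
      begin
        alongIn y (μ (Cf (suc t))) + (recvBefore y t + recvAlong y (ev t))
      ≡⟨ cong₂ (λ u v → u + (recvBefore y t + v)) (trans (cong (alongIn y) μ') (count-∷ (along? y) m _))
                                                   (cong (countIn (_≟R y)) noRecv) ⟩
        (countIn (along? y) (just m) + alongIn y (μ (Cf t))) + (recvBefore y t + 0)
      ≡⟨ rearrange-emit (countIn (along? y) (just m)) (alongIn y (μ (Cf t))) (recvBefore y t) ⟩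
        (alongIn y (μ (Cf t)) + recvBefore y t) + countIn (along? y) (just m)
      ≡⟨ cong (_+ _) ih ⟩
        sentBefore y t + countIn (along? y) (just m)
      ≡⟨ cong (λ v → sentBefore y t + countIn (along? y) v) (sym (emitted-Emits em)) ⟩
        sentBefore y t + sentAlong y (ev t)
      ∎
    ... | consumes m _ noEmit perm how | ih =
      begin
        alongIn y (μ (Cf (suc t))) + (recvBefore y t + recvAlong y (ev t))
      ≡⟨ cong (λ v → alongIn y (μ (Cf (suc t))) + (recvBefore y t + v)) (receivedCount how) ⟩
        alongIn y (μ (Cf (suc t))) + (recvBefore y t + countIn (along? y) (just m))
      ≡⟨ rearrange-consume (countIn (along? y) (just m)) (alongIn y (μ (Cf (suc t)))) (recvBefore y t) ⟩
        (countIn (along? y) (just m) + alongIn y (μ (Cf (suc t))) + recvBefore y t) + 0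
      ≡⟨ cong (λ v → (v + recvBefore y t) + 0) before ⟩
        (alongIn y (μ (Cf t)) + recvBefore y t) + 0
      ≡⟨ cong (_+ 0) ih ⟩
        sentBefore y t + 0
      ≡⟨ cong (λ v → sentBefore y t + countIn (along? y) v) (sym noEmit) ⟩
        sentBefore y t + sentAlong y (ev t)
      ∎
      where
      before : countIn (along? y) (just m) + alongIn y (μ (Cf (suc t))) ≡ alongIn y (μ (Cf t))
      before = sym (trans (↭-length (filter-↭ (along? y) perm)) (count-∷ (along? y) m _))
      -- a consumed message along y is a received one, since y is not
      -- released now and does not target an external actor
      receivedCount : Consumption (Cf t) (ev t) m → recvAlong y (ev t) ≡ countIn (along? y) (just m)
      receivedCount (receipt rc _) = trans (cong (countIn (_≟R y)) rc) (sym (countIn-along y m))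
      receivedCount (disposal noRecv why) with same-or-distinct (along (body m)) y
      ... | inj₂ m≢y  = trans (cong (countIn (_≟R y)) noRecv) (sym (countIn-miss (along? y) {m} m≢y))
      ... | inj₁ refl =
        ⊥-elim ([ proj₂ (not-before-suc notRel) , (λ ext → notExt (proj₁ (stepExternal (step lt)) ext)) ] why)
    ... | silent noEmit noRecv _ μ' | ih =
      begin
        alongIn y (μ (Cf (suc t))) + (recvBefore y t + recvAlong y (ev t))
      ≡⟨ cong₂ (λ u v → alongIn y u + (recvBefore y t + v)) μ' (cong (countIn (_≟R y)) noRecv) ⟩
        0 + alongIn y (μ (Cf t)) + (recvBefore y t + 0)
      ≡⟨ rearrange-emit 0 (alongIn y (μ (Cf t))) (recvBefore y t) ⟩
        (alongIn y (μ (Cf t)) + recvBefore y t) + 0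
      ≡⟨ cong (_+ 0) ih ⟩
        sentBefore y t + 0
      ≡⟨ cong (λ v → sentBefore y t + countIn (along? y) v) (sym noEmit) ⟩
        sentBefore y t + sentAlong y (ev t)
      ∎

  emittedBy : ∀ {s m} → s < len → emitted (ev s) ≡ just m → Emits (ev s) (own (along (body m))) m
  emittedBy lt em with stepMailbox (step lt)
  ... | emits _ em₀ _ _ _ _ _   =
    subst (λ m → Emits _ (own (along (body m))) m) (just-injective (trans (sym (emitted-Emits em₀)) em)) em₀
  ... | consumes _ _ noEmit _ _ = ⊥-elim (both-emitted noEmit em)
  ... | silent noEmit _ _ _     = ⊥-elim (both-emitted noEmit em)

  history : ℕ → ℕ → List TMsg
  history a zero    = []
  history a (suc k) = history a k ++ fromMaybe (emitted (ev (a + k)))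

  alongIn-++ : ∀ y xs ys → alongIn y (xs ++ ys) ≡ alongIn y xs + alongIn y ys
  alongIn-++ y xs ys = trans (cong length (filter-++ (along? y) xs ys)) (length-++ (filter (along? y) xs))

  sent-history : ∀ y a k → sentBefore y (a + k) ≡ sentBefore y a + alongIn y (history a k)
  sent-history y a zero    = trans (cong (sentBefore y) (+-identityʳ a)) (sym (+-identityʳ _))
  sent-history y a (suc k) =
    begin
      sentBefore y (a + suc k)
    ≡⟨ cong (sentBefore y) (+-suc a k) ⟩
      sentBefore y (a + k) + sentAlong y (ev (a + k))
    ≡⟨ cong (_+ sentAlong y (ev (a + k))) (sent-history y a k) ⟩
      (sentBefore y a + alongIn y (history a k)) + sentAlong y (ev (a + k))
    ≡⟨ +-assoc (sentBefore y a) _ _ ⟩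
      sentBefore y a + (alongIn y (history a k) + sentAlong y (ev (a + k)))
    ≡⟨ cong (sentBefore y a +_) (sym (alongIn-++ y (history a k) _)) ⟩
      sentBefore y a + alongIn y (history a (suc k))
    ∎

  history⁻ : ∀ {a k x} → a + k ≤ len → x ∈ history a k →
    a ≤ tag x × tag x < a + k × Emits (ev (tag x)) (own (along (body x))) x
  history⁻ {a} {suc k} {x} bound x∈ with ∈-++⁻ (history a k) x∈
  ... | inj₁ earlier =
    let a≤ , below , em = history⁻ {a} {k} (≤-trans (+-monoʳ-≤ a (n≤1+n k)) bound) earlier
    in  a≤ , <-≤-trans below (+-monoʳ-≤ a (n≤1+n k)) , em
  ... | inj₂ current =
    subst (a ≤_) (sym tg) (m≤m+n a k) , subst (_< a + suc k) (sym tg) (+-monoʳ-< a (n<1+n k)) ,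
    subst (λ s → Emits (ev s) _ x) (sym tg) em
    where
    lt : a + k < len
    lt = <-≤-trans (+-monoʳ-< a (n<1+n k)) bound
    em : Emits (ev (a + k)) (own (along (body x))) x
    em = emittedBy lt (∈-fromMaybe _ current)
    tg : tag x ≡ a + k
    tg = tag-emitted lt em

  history⁺ : ∀ {a k s A x} → a ≤ s → s < a + k → Emits (ev s) A x → x ∈ history a k
  history⁺ {a} {zero} {s} a≤s s<a+0 _ = ⊥-elim (<⇒≱ (subst (s <_) (+-identityʳ a) s<a+0) a≤s)
  history⁺ {a} {suc k} {s} a≤s s<a+k' em with below-suc (subst (s <_) (+-suc a k) s<a+k')
  ... | inj₁ s<a+k = ∈-++⁺ˡ (history⁺ a≤s s<a+k em)
  ... | inj₂ refl  = ∈-++⁺ʳ (history a k) (subst (λ mm → _ ∈ fromMaybe mm) (sym (emitted-Emits em)) (here refl))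

  history-unique : ∀ a k → a + k ≤ len → Unique (history a k)
  history-unique a zero    _     = []
  history-unique a (suc k) bound = ++⁺ (history-unique a k bound') single disjoint
    where
    bound' : a + k ≤ len
    bound' = ≤-trans (+-monoʳ-≤ a (n≤1+n k)) bound
    single : Unique (fromMaybe (emitted (ev (a + k))))
    single with emitted (ev (a + k))
    ... | just _  = All.[] ∷ []
    ... | nothing = []
    disjoint : ∀ {x} → ¬ (x ∈ history a k × x ∈ fromMaybe (emitted (ev (a + k))))
    disjoint (earlier , current) =
      <⇒≢ (proj₁ (proj₂ (history⁻ {a} {k} bound' earlier))) (tag-emitted now (emittedBy now (∈-fromMaybe _ current)))
      where
      now : a + k < len
      now = <-≤-trans (+-monoʳ-< a (n<1+n k)) bound

  derivation : ∀ {t A φ} → Derives E t A φ → Σ (Knowledge × Status) λ w → α (Cf t) A ≡ just w × proj₁ w ⊢ φ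
  derivation {t} {A} d = known (α (Cf t) A) d
    where
    known : ∀ {φ} (mw : Maybe (Knowledge × Status)) → KnowsIn mw φ →
      Σ (Knowledge × Status) λ w → mw ≡ just w × proj₁ w ⊢ φ
    known (just w) d = w , refl , d

  -- The messages along x pending between t₁ and t₂, assuming that x is not
  -- used by its owner during [t₁, t₂): those along x still in μ at t₂ and,
  -- when t₂ ≤ t₁, those sent along x during [t₂, t₁).
  module Pending (x : Refob) {t₁ t₂ : ℕ} (t₁≤len : t₁ ≤ len) (t₂≤len : t₂ ≤ len)
    (quiet : t₁ < t₂ → ∀ s msg → t₁ ≤ s → s < t₂ → Emits (ev s) (own x) msg → along (body msg) ≢ x) where

    silentBetween : ∀ {s A m} → t₁ ≤ s → s < t₂ → Emits (ev s) A m → ¬ Along x m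
    silentBetween {s} {m = m} t₁≤s s<t₂ em al =
      quiet (≤-<-trans t₁≤s s<t₂) s m t₁≤s s<t₂
        (subst (λ B → Emits (ev s) B m) (cong own al) (emittedBy (<-≤-trans s<t₂ t₂≤len) (emitted-Emits em))) al

    gap : ℕ
    gap = t₁ ∸ t₂

    gap-cases : (t₂ ≤ t₁ × t₂ + gap ≡ t₁) ⊎ (t₁ < t₂ × t₂ + gap ≡ t₂)
    gap-cases with t₂ ≤? t₁
    ... | yes t₂≤t₁ = inj₁ (t₂≤t₁ , m+[n∸m]≡n t₂≤t₁)
    ... | no  t₂≰t₁ = inj₂ (t₁<t₂ , trans (cong (t₂ +_) (m≤n⇒m∸n≡0 (<⇒≤ t₁<t₂))) (+-identityʳ t₂))
      where
      t₁<t₂ = ≰⇒> t₂≰t₁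

    end≤len : t₂ + gap ≤ len
    end≤len with gap-cases
    ... | inj₁ (_ , end≡t₁) = subst (_≤ len) (sym end≡t₁) t₁≤len
    ... | inj₂ (_ , end≡t₂) = subst (_≤ len) (sym end≡t₂) t₂≤len

    inGap⇒<t₁ : ∀ {s} → t₂ ≤ s → s < t₂ + gap → s < t₁
    inGap⇒<t₁ {s} t₂≤s s<end with gap-cases
    ... | inj₁ (_ , end≡t₁) = subst (s <_) end≡t₁ s<end
    ... | inj₂ (_ , end≡t₂) = ⊥-elim (<⇒≱ (subst (s <_) end≡t₂ s<end) t₂≤s)

    <t₁⇒inGap : ∀ {s} → t₂ ≤ s → s < t₁ → s < t₂ + gap
    <t₁⇒inGap {s} t₂≤s s<t₁ = subst (s <_) (sym (m+[n∸m]≡n (≤-trans t₂≤s (<⇒≤ s<t₁)))) s<t₁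

    sent-t₁ : sentBefore x t₁ ≡ sentBefore x t₂ + alongIn x (history t₂ gap)
    sent-t₁ with gap-cases
    ... | inj₁ (_ , end≡t₁) = trans (cong (sentBefore x) (sym end≡t₁)) (sent-history x t₂ gap)
    ... | inj₂ (t₁<t₂ , end≡t₂) =
      begin
        sentBefore x t₁
      ≡⟨ sym (+-identityʳ _) ⟩
        sentBefore x t₁ + 0
      ≡⟨ cong (sentBefore x t₁ +_) (sym nothingBetween) ⟩
        sentBefore x t₁ + alongIn x (history t₁ (t₂ ∸ t₁))
      ≡⟨ sym (sent-history x t₁ (t₂ ∸ t₁)) ⟩
        sentBefore x (t₁ + (t₂ ∸ t₁))
      ≡⟨ cong (sentBefore x) (trans (m+[n∸m]≡n (<⇒≤ t₁<t₂)) (sym end≡t₂)) ⟩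
        sentBefore x (t₂ + gap)
      ≡⟨ sent-history x t₂ gap ⟩
        sentBefore x t₂ + alongIn x (history t₂ gap)
      ∎
      where
      nothingBetween : alongIn x (history t₁ (t₂ ∸ t₁)) ≡ 0
      nothingBetween = cong length (filter-none (along? x) (All.tabulate notAlong))
        where
        bound : t₁ + (t₂ ∸ t₁) ≤ len
        bound = subst (_≤ len) (sym (m+[n∸m]≡n (<⇒≤ t₁<t₂))) t₂≤len
        notAlong : ∀ {m} → m ∈ history t₁ (t₂ ∸ t₁) → ¬ Along x m
        notAlong {m} m∈ with history⁻ {t₁} {t₂ ∸ t₁} bound m∈
        ... | t₁≤tag , tag<end , em = silentBetween t₁≤tag (subst (tag m <_) (m+[n∸m]≡n (<⇒≤ t₁<t₂)) tag<end) em

    box : Mailbox t₂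
    box = mailboxAt t₂ t₂≤len

    inMailbox inGap pendingList : List TMsg
    inMailbox   = filter (along? x) (μ (Cf t₂))
    inGap       = filter (along? x) (history t₂ gap)
    pendingList = inMailbox ++ inGap

    -- Messages in μ at t₂ were emitted before t₂, those of the gap after.
    pendingList-unique : Unique pendingList
    pendingList-unique =
      ++⁺ (filter⁺ (along? x) (Mailbox.distinct box)) (filter⁺ (along? x) (history-unique t₂ gap end≤len)) separated
      where
      separated : ∀ {m} → ¬ (m ∈ inMailbox × m ∈ inGap)
      separated (inμ , inHist) with Mailbox.pending box (proj₁ (∈-filter⁻ (along? x) inμ))
      ... | (s , s<t₂ , _ , em) , _ =
        <⇒≱ (subst (_< t₂) (sym (tag-emitted (<-≤-trans s<t₂ t₂≤len) em)) s<t₂)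
            (proj₁ (history⁻ end≤len (proj₁ (∈-filter⁻ (along? x) inHist))))

    pendingList-exact : ∀ m → m ∈ pendingList ⇔ PendingAlong E x t₁ t₂ m
    pendingList-exact m = mk⇔ to from
      where
      to : m ∈ pendingList → PendingAlong E x t₁ t₂ m
      to m∈ with ∈-++⁻ inMailbox m∈
      ... | inj₁ inμ with ∈-filter⁻ (along? x) inμ
      ...   | m∈μ , al with Mailbox.pending box m∈μ
      ...     | (s , s<t₂ , A , em) , unconsumed with s <? t₁
      ...       | yes s<t₁ = (s , s<t₁ , A , em) , al , unconsumed
      ...       | no  s≮t₁ = ⊥-elim (silentBetween (≮⇒≥ s≮t₁) s<t₂ em al)
      to m∈ | inj₂ inHist with ∈-filter⁻ (along? x) inHist
      ... | m∈hist , al with history⁻ end≤len m∈hist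
      ...   | t₂≤tag , tag<end , em = (tag m , inGap⇒<t₁ t₂≤tag tag<end , _ , em) , al , unconsumed
        where
        -- a message consumed before t₂ was emitted before t₂
        unconsumed : ¬ Consumed m t₂
        unconsumed (r , r<t₂ , c) with Mailbox.causal box r<t₂ c
        ... | s , s<r , _ , em' =
          <⇒≱ (subst (_< t₂) (sym (tag-emitted (<-trans s<r (<-≤-trans r<t₂ t₂≤len)) em')) (<-trans s<r r<t₂))
              t₂≤tag
      from : PendingAlong E x t₁ t₂ m → m ∈ pendingList
      from ((s , s<t₁ , A , em) , al , unconsumed) with s <? t₂
      ... | yes s<t₂ = ∈-++⁺ˡ (∈-filter⁺ (along? x) (Mailbox.complete box (s , s<t₂ , A , em) unconsumed) al)
      ... | no  s≮t₂ =
        ∈-++⁺ʳ inMailbox (∈-filter⁺ (along? x) (history⁺ (≮⇒≥ s≮t₂) (<t₁⇒inGap (≮⇒≥ s≮t₂) s<t₁) em) al)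

    pendingList-balance : ¬ ReleasedBefore E x t₂ → ¬ χ (Cf t₂) (tgt x) →
      length pendingList + recvBefore x t₂ ≡ sentBefore x t₁
    pendingList-balance notRel notExt =
      begin
        length pendingList + recvBefore x t₂
      ≡⟨ cong (_+ recvBefore x t₂) (length-++ inMailbox) ⟩
        (alongIn x (μ (Cf t₂)) + alongIn x (history t₂ gap)) + recvBefore x t₂
      ≡⟨ rearrange (alongIn x (μ (Cf t₂))) (alongIn x (history t₂ gap)) (recvBefore x t₂) ⟩
        (alongIn x (μ (Cf t₂)) + recvBefore x t₂) + alongIn x (history t₂ gap)
      ≡⟨ cong (_+ alongIn x (history t₂ gap)) (inFlightAt t₂ t₂≤len x notRel notExt) ⟩
        sentBefore x t₂ + alongIn x (history t₂ gap)
      ≡⟨ sym sent-t₁ ⟩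
        sentBefore x t₁
      ∎
      where
      rearrange : ∀ a h r → (a + h) + r ≡ (a + r) + h
      rearrange = solve-∀

mainTheorem8 : (E : Execution) (x : Refob) (t₁ t₂ n m : ℕ) →
    t₁ ≤ Execution.len E → t₂ ≤ Execution.len E →
    ¬ DeactivatedBefore E x t₁ →
    ¬ ReleasedBefore E x t₂ →
    Derives E t₁ (own x) (SentCount x n) →
    Derives E t₂ (tgt x) (RecvCount x m) →
    (t₁ < t₂ → ∀ s msg → t₁ ≤ s → s < t₂ →
      Emits (Execution.ev E s) (own x) msg → along (body msg) ≢ x) →
    HasCard (PendingAlong E x t₁ t₂) (n ∸ m)
mainTheorem8 E x t₁ t₂ n m t₁≤len t₂≤len notDeact notRel sentN recvM quiet =
  pendingList , pendingList-unique , pendingList-exact , count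
  where
  open Run E
  open Pending x t₁≤len t₂≤len quiet
  -- n and m count the messages sent before t₁ and received before t₂,
  -- which the pending list together with the received ones balances.
  count : length pendingList ≡ n ∸ m
  count with derivation {t₁} {own x} sentN | derivation {t₂} {tgt x} recvM
  ... | _ , ownerLook , ownerDerives | _ , targetLook , targetDerives =
    begin
      length pendingList
    ≡⟨ sym (m+n∸n≡m (length pendingList) (recvBefore x t₂)) ⟩
      (length pendingList + recvBefore x t₂) ∸ recvBefore x t₂
    ≡⟨ cong (_∸ recvBefore x t₂) (pendingList-balance notRel (disjointAt t₂ t₂≤len (isJust targetLook))) ⟩
      sentBefore x t₁ ∸ recvBefore x t₂
    ≡⟨ sym (cong₂ _∸_ (sentCountsAt t₁ t₁≤len ownerLook refl notDeact n ownerDerives)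
                      (recvCountsAt t₂ t₂≤len targetLook refl notRel m targetDerives)) ⟩
      n ∸ m
    ∎
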